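{- Let $q\ge 8$ be even and $\mu\in\mathbb{F}_q\setminus\{0,1\}$. Let $\ell_\mu$ be the line through $R_{\mu,0}=\mathrm{P}(0,\mu,0,1)$ and $R_{\mu,\infty}=\mathrm{P}(1,0,1,0)$. Then the subgroup $G_q^{\ell_\mu}$ of $G_q$ fixing $\ell_\mu$ has order $2$, and the orbit of $\ell_\mu$ under $G_q$ has size $(q^3-q)/2$. The non-trivial element $\psi$ of $G_q^{\ell_\mu}$ is induced by the matrix $\begin{pmatrix}0&0&0&1\\0&0&\sqrt{\mu}&0\\0&\mu&0&0\\ \sqrt{\mu^3}&0&0&0\end{pmatrix}$ (where $\sqrt{\cdot}$ denotes the unique square root in $\mathbb{F}_q$), and $R_{\mu,\infty}\psi=R_{\mu,0}$, $R_{\mu,0}\psi=R_{\mu,\infty}$.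
   Context: $\mathbb{F}_q$ is the finite field of order $q$, and $\mathrm{P}(x_0,x_1,x_2,x_3)$ denotes a point of $\mathrm{PG}(3,q)$ in homogeneous coordinates. The twisted cubic is $\mathcal{C}=\{P(t): t\in\mathbb{F}_q\cup\{\infty\}\}$, $P(t)=\mathrm{P}(t^3,t^2,t,1)$ for $t\in\mathbb{F}_q$, $P(\infty)=\mathrm{P}(1,0,0,0)$. $G_q$ is the group of projectivities of $\mathrm{PG}(3,q)$ mapping $\mathcal{C}$ onto itself; for $q\ge5$ it has order $q^3-q$ and its elements are exactly the maps $\mathrm{P}(x)\mapsto\mathrm{P}(xM)$ ($x$ a row vector) with $M=\begin{pmatrix} a^3&a^2c&ac^2&c^3\\ 3a^2b&a^2d+2abc&bc^2+2acd&3c^2d\\ 3ab^2&b^2c+2abd&ad^2+2bcd&3cd^2\\ b^3&b^2d&bd^2&d^3\end{pmatrix}$, $a,b,c,d\in\mathbb{F}_q$, $ad-bc\ne0$ (proportional matrices give the same projectivity). -}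

module Defs where

open import Level using (0ℓ)
open import Algebra.Bundles using (CommutativeRing)
open import Data.Nat as ℕ using (ℕ)
open import Data.Fin as Fin using (Fin)
open import Data.Vec using (Vec; []; _∷_; lookup)
open import Data.Product using (Σ; ∃; _×_; _,_)
open import Data.Sum using (_⊎_)
open import Relation.Nullary using (¬_)
open import Relation.Binary.PropositionalEquality using (_≡_)

record FiniteField : Set₁ where
  field
    commRing : CommutativeRing 0ℓ 0ℓ
  open CommutativeRing commRing public
  field
    0≉1      : ¬ (0# ≈ 1#)
    inverse  : ∀ x → ¬ (x ≈ 0#) → ∃ λ y → x * y ≈ 1#
    order    : ℕ
    enum     : Fin order → Carrier
    enum-inj : ∀ i j → enum i ≈ enum j → i ≡ j
    enum-sur : ∀ x → ∃ λ i → enum i ≈ x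

HasSize : {A : Set} → (A → Set) → (A → A → Set) → ℕ → Set
HasSize {A} P _~_ n =
  Σ (Vec A n) λ xs →
    (∀ i → P (lookup xs i)) ×
    (∀ i j → lookup xs i ~ lookup xs j → i ≡ j) ×
    (∀ y → P y → ∃ λ i → y ~ lookup xs i)

module Geometry (F : FiniteField) where
  open FiniteField F public

  V4 : Set
  V4 = Fin 4 → Carrier

  Mat4 : Set
  Mat4 = Fin 4 → Fin 4 → Carrier

  i0 i1 i2 i3 : Fin 4
  i0 = Fin.zero
  i1 = Fin.suc Fin.zero
  i2 = Fin.suc (Fin.suc Fin.zero)
  i3 = Fin.suc (Fin.suc (Fin.suc Fin.zero))

  vec : Carrier → Carrier → Carrier → Carrier → V4
  vec a b c d = lookup (a ∷ b ∷ c ∷ d ∷ [])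

  mat : Vec (Vec Carrier 4) 4 → Mat4
  mat rows i j = lookup (lookup rows i) j

  _·_ : V4 → Mat4 → V4
  (x · M) j = x i0 * M i0 j + x i1 * M i1 j + x i2 * M i2 j + x i3 * M i3 j

  SamePoint : V4 → V4 → Set
  SamePoint v w = ∃ λ λ′ → ¬ (λ′ ≈ 0#) × (∀ i → w i ≈ λ′ * v i)

  SameProj : Mat4 → Mat4 → Set
  SameProj M N = ∃ λ λ′ → ¬ (λ′ ≈ 0#) × (∀ i j → N i j ≈ λ′ * M i j)

  Line : Set
  Line = V4 × V4

  InSpan : Line → V4 → Set
  InSpan (u , v) w = ∃ λ α → ∃ λ β → ∀ i → w i ≈ α * u i + β * v i

  SameLine : Line → Line → Set
  SameLine (u , v) (u′ , v′) =
    InSpan (u , v) u′ × InSpan (u , v) v′ × InSpan (u′ , v′) u × InSpan (u′ , v′) v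

  _·ᴸ_ : Line → Mat4 → Line
  (u , v) ·ᴸ M = (u · M , v · M)

  two three : Carrier
  two   = 1# + 1#
  three = 1# + 1# + 1#

  record GElt : Set where
    constructor gelt
    field
      a b c d : Carrier
      det≉0   : ¬ (a * d - b * c ≈ 0#)

  M : GElt → Mat4
  M (gelt a b c d _) = mat
    ( (a * a * a ∷ a * a * c ∷ a * c * c ∷ c * c * c ∷ [])
    ∷ (three * a * a * b ∷ a * a * d + two * a * b * c ∷ b * c * c + two * a * c * d ∷ three * c * c * d ∷ [])
    ∷ (three * a * b * b ∷ b * b * c + two * a * b * d ∷ a * d * d + two * b * c * d ∷ three * c * d * d ∷ [])
    ∷ (b * b * b ∷ b * b * d ∷ b * d * d ∷ d * d * d ∷ [])
    ∷ [])

  I4 : Mat4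
  I4 = mat ( (1# ∷ 0# ∷ 0# ∷ 0# ∷ [])
           ∷ (0# ∷ 1# ∷ 0# ∷ 0# ∷ [])
           ∷ (0# ∷ 0# ∷ 1# ∷ 0# ∷ [])
           ∷ (0# ∷ 0# ∷ 0# ∷ 1# ∷ []) ∷ [])

  _≈G_ : GElt → GElt → Set
  g ≈G h = SameProj (M g) (M h)

  Fixes : Line → GElt → Set
  Fixes ℓ g = SameLine (ℓ ·ᴸ M g) ℓ

  InOrbit : Line → Line → Set
  InOrbit ℓ L = ∃ λ (g : GElt) → SameLine (ℓ ·ᴸ M g) L

  R0 : Carrier → V4
  R0 μ = vec 0# μ 0# 1#

  R∞ : V4
  R∞ = vec 1# 0# 1# 0#

  ℓ : Carrier → Line
  ℓ μ = (R0 μ , R∞)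

  -- the matrix of ψ, with s = √μ and t = √(μ³)
  Ψ : Carrier → Carrier → Carrier → Mat4
  Ψ μ s t = mat ( (0# ∷ 0# ∷ 0# ∷ 1# ∷ [])
                ∷ (0# ∷ 0# ∷ s ∷ 0# ∷ [])
                ∷ (0# ∷ μ ∷ 0# ∷ 0# ∷ [])
                ∷ (t ∷ 0# ∷ 0# ∷ 0# ∷ []) ∷ [])

{-# OPTIONS --safe #-}
module Submission where

open import Defs
open import Data.Nat using (ℕ; zero; suc; _≤_; _^_; _∸_; _/_)
open import Data.Nat.Divisibility using (_∣_)
open import Data.Product using (∃; _×_)
open import Relation.Nullary using (¬_)

open import Level using (0ℓ)
open import Algebra.Bundles using (CommutativeRing; RawRing)
open import Relation.Binary.Bundles using (Setoid)
import Relation.Binary.Reasoning.Setoid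
import Data.Nat as ℕ
import Data.Nat.Properties as ℕₚ
open import Data.Nat.DivMod using (m*n/n≡m)
open import Data.Nat.Solver using (module +-*-Solver)
open import Data.Nat.Divisibility using (divides; ∣m+n∣m⇒∣n; ∣1⇒≡1)
open import Data.Bool using (Bool; true; false; not; if_then_else_; _xor_; _∧_)
open import Data.Fin as Fin using (Fin; zero; suc; _<_; _<?_; #_)
open import Data.Fin.Patterns using (0F; 1F; 2F; 3F)
import Data.Fin.Properties as Finₚ
import Data.Fin.Permutation as Permutation
open import Data.Vec as Vec using (Vec; []; _∷_; lookup)
import Data.Vec.Relation.Binary.Pointwise.Inductive as Pointwise
open Pointwise using (Pointwise; []; _∷_)
import Data.Vec.Properties as Vecₚ
open import Data.Product using (_,_; proj₁; proj₂)
open import Data.Sum as Sum using (_⊎_; inj₁; inj₂)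
open import Relation.Nullary using (Dec; yes; no; does; contradiction)
open import Relation.Nullary.Decidable using (dec-true; dec-false)
open import Relation.Binary.Definitions using (tri<; tri≈; tri>)
open import Relation.Binary.PropositionalEquality as ≡ using (_≡_; _≢_)
open import Function using (_∘_; _↔_; Inverse)
open import Function.Properties.Inverse using (↔-refl; ↔-trans)
open import Data.Sum.Function.Propositional using (_⊎-↔_)
open import Data.Product.Function.NonDependent.Propositional using (_×-↔_)
open import Data.Maybe using (nothing)
open import Algebra.Properties.CommutativeMonoid.Sum ℕₚ.+-0-commutativeMonoid
  using (sum; sum-permute)

-- Over a field of characteristic 2, an element g of G_q (taken up to a scalar) fixes
-- ℓ_μ iff the images of R_{μ,0} and R_{μ,∞} satisfy the equations x₀ = x₂ and x₁ = μ x₃ of ℓ_μ.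
-- Writing μ = s², these four cubic conditions factor as a coordinate of g times a square, and
-- since s ∉ {0, 1} they leave only the identity and ψ = (0, s, 1, 0). So the stabiliser has order 2.
-- Enumerating G_q by normal forms, left multiplication by ψ is a fixed-point-free involution whose
-- orbits are exactly the fibres of g ↦ ℓ_μ g, hence the orbit of ℓ_μ has (q³ - q)/2 elements.

-- The left-hand side counts the normal forms of Char2Geometry.Code, with q = n + 1.
|PGL₂| : ∀ n → n ℕ.* suc n ℕ.+ suc n ℕ.* suc n ℕ.* n ≡ suc n ^ 3 ∸ suc n
|PGL₂| n = ≡.sym (≡.trans (≡.cong (_∸ suc n) (expand n)) (ℕₚ.m+n∸n≡m _ (suc n)))
  where
  open +-*-Solver
  expand : ∀ n → suc n ^ 3 ≡ n ℕ.* suc n ℕ.+ suc n ℕ.* suc n ℕ.* n ℕ.+ suc n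
  expand = solve 1 (λ n → (con 1 :+ n) :^ 3 := n :* (con 1 :+ n) :+ (con 1 :+ n) :* (con 1 :+ n) :* n :+ (con 1 :+ n)) ≡.refl

2∤1+m+m : ∀ m → ¬ 2 ∣ suc (m ℕ.+ m)
2∤1+m+m m 2∣1+m+m = contradiction (∣1⇒≡1 (∣m+n∣m⇒∣n 2∣m+m+1 2∣m+m)) λ ()
  where
  2∣m+m+1 : 2 ∣ m ℕ.+ m ℕ.+ 1
  2∣m+m+1 = ≡.subst (2 ∣_) (ℕₚ.+-comm 1 (m ℕ.+ m)) 2∣1+m+m
  2∣m+m : 2 ∣ m ℕ.+ m
  2∣m+m = divides m (≡.trans (≡.cong (m ℕ.+_) (≡.sym (ℕₚ.+-identityʳ m))) (ℕₚ.*-comm 2 m))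

-- Counting on Fin

count : ∀ {n} → (Fin n → Bool) → ℕ
count p = sum (λ i → if p i then 1 else 0)

count-cong : ∀ {n} {p p′ : Fin n → Bool} → (∀ i → p i ≡ p′ i) → count p ≡ count p′
count-cong {zero}  eq = ≡.refl
count-cong {suc n} eq =
  ≡.cong₂ ℕ._+_ (≡.cong (λ b → if b then 1 else 0) (eq zero)) (count-cong (eq ∘ suc))

count+count-not : ∀ {n} (p : Fin n → Bool) → count p ℕ.+ count (not ∘ p) ≡ n
count+count-not {zero}  p = ≡.refl
count+count-not {suc n} p with p zero | count+count-not (p ∘ suc)
... | true  | ih = ≡.cong suc ih
... | false | ih = ≡.trans (ℕₚ.+-suc (count (p ∘ suc)) _) (≡.cong suc ih)

count-∘-involution : ∀ {n} (p : Fin n → Bool) {σ : Fin n → Fin n} →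
                     (∀ i → σ (σ i) ≡ i) → count (p ∘ σ) ≡ count p
count-∘-involution p {σ} σσ = ≡.sym (sum-permute _ (Permutation.permutation σ σ σσ σσ))

select : ∀ {n} (p : Fin n → Bool) → Vec (Fin n) (count p)
select {zero}  p = []
select {suc n} p with p zero
... | true  = zero ∷ Vec.map Fin.suc (select (p ∘ suc))
... | false = Vec.map Fin.suc (select (p ∘ suc))

select-satisfies : ∀ {n} (p : Fin n → Bool) k → p (lookup (select p) k) ≡ true
select-satisfies {suc n} p k with p zero in eq
select-satisfies {suc n} p zero    | true = eq
select-satisfies {suc n} p (suc k) | true
  rewrite Vecₚ.lookup-map k Fin.suc (select (p ∘ suc)) = select-satisfies (p ∘ suc) k
select-satisfies {suc n} p k       | false
  rewrite Vecₚ.lookup-map k Fin.suc (select (p ∘ suc)) = select-satisfies (p ∘ suc) k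

select-injective : ∀ {n} (p : Fin n → Bool) {k l} →
                   lookup (select p) k ≡ lookup (select p) l → k ≡ l
select-injective {suc n} p {k} {l} eq with p zero
select-injective {suc n} p {zero}  {zero}  eq | true = ≡.refl
select-injective {suc n} p {zero}  {suc l} eq | true
  rewrite Vecₚ.lookup-map l Fin.suc (select (p ∘ suc)) with () ← eq
select-injective {suc n} p {suc k} {zero}  eq | true
  rewrite Vecₚ.lookup-map k Fin.suc (select (p ∘ suc)) with () ← eq
select-injective {suc n} p {suc k} {suc l} eq | true
  rewrite Vecₚ.lookup-map k Fin.suc (select (p ∘ suc)) | Vecₚ.lookup-map l Fin.suc (select (p ∘ suc)) =
  ≡.cong suc (select-injective (p ∘ suc) (Finₚ.suc-injective eq))
select-injective {suc n} p {k} {l} eq | false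
  rewrite Vecₚ.lookup-map k Fin.suc (select (p ∘ suc)) | Vecₚ.lookup-map l Fin.suc (select (p ∘ suc)) =
  select-injective (p ∘ suc) (Finₚ.suc-injective eq)

select-complete : ∀ {n} (p : Fin n → Bool) i → p i ≡ true → ∃ λ k → lookup (select p) k ≡ i
select-complete {suc n} p i pi with p zero in eq
select-complete {suc n} p zero    pi | true = zero , ≡.refl
select-complete {suc n} p (suc i) pi | true with k , e ← select-complete (p ∘ suc) i pi =
  suc k , ≡.trans (Vecₚ.lookup-map k Fin.suc (select (p ∘ suc))) (≡.cong suc e)
select-complete {suc n} p zero    pi | false with () ← ≡.trans (≡.sym eq) pi
select-complete {suc n} p (suc i) pi | false with k , e ← select-complete (p ∘ suc) i pi =
  k , ≡.trans (Vecₚ.lookup-map k Fin.suc (select (p ∘ suc))) (≡.cong suc e)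

module FixedPointFreeInvolution {n} (σ : Fin n → Fin n)
  (σ-involutive : ∀ i → σ (σ i) ≡ i) (σ-fixpointFree : ∀ i → σ i ≢ i) where

  below : Fin n → Bool
  below i = does (i <? σ i)

  below-σ : ∀ i → below (σ i) ≡ not (below i)
  below-σ i with Finₚ.<-cmp i (σ i)
  ... | tri< i<σi _ _ =
    ≡.trans (dec-false (σ i <? σ (σ i)) λ σi<σσi → Finₚ.<-asym i<σi (≡.subst (σ i <_) (σ-involutive i) σi<σσi))
            (≡.cong not (≡.sym (dec-true (i <? σ i) i<σi)))
  ... | tri≈ _ i≡σi _ = contradiction (≡.sym i≡σi) (σ-fixpointFree i)
  ... | tri> _ _ σi<i =
    ≡.trans (dec-true (σ i <? σ (σ i)) (≡.subst (σ i <_) (≡.sym (σ-involutive i)) σi<i))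
            (≡.cong not (≡.sym (dec-false (i <? σ i) (Finₚ.<-asym σi<i))))

  half : ℕ
  half = count below

  n≡half+half : n ≡ half ℕ.+ half
  n≡half+half = begin
    n                                ≡⟨ count+count-not below ⟨
    half ℕ.+ count (not ∘ below)     ≡⟨ ≡.cong (half ℕ.+_) (count-cong below-σ) ⟨
    half ℕ.+ count (below ∘ σ)       ≡⟨ ≡.cong (half ℕ.+_) (count-∘-involution below σ-involutive) ⟩
    half ℕ.+ half                    ∎
    where open ≡.≡-Reasoning

  n/2≡half : n / 2 ≡ half
  n/2≡half = begin
    n / 2                ≡⟨ ≡.cong (_/ 2) n≡half+half ⟩
    (half ℕ.+ half) / 2  ≡⟨ ≡.cong (λ m → (half ℕ.+ m) / 2) (ℕₚ.+-identityʳ half) ⟨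
    (2 ℕ.* half) / 2     ≡⟨ ≡.cong (_/ 2) (ℕₚ.*-comm 2 half) ⟩
    (half ℕ.* 2) / 2     ≡⟨ m*n/n≡m half 2 ⟩
    half                 ∎
    where open ≡.≡-Reasoning

  representatives : Vec (Fin n) half
  representatives = select below

  representative-below : ∀ k → lookup representatives k < σ (lookup representatives k)
  representative-below k = from-does (_ <? _) (select-satisfies below k)
    where
    from-does : ∀ {A : Set} (a? : Dec A) → does a? ≡ true → A
    from-does (yes a) _ = a

  representative-injective : ∀ {k l} → lookup representatives k ≡ lookup representatives l → k ≡ l
  representative-injective = select-injective below

  representative-covers : ∀ i → (∃ λ k → lookup representatives k ≡ i) ⊎ (∃ λ k → lookup representatives k ≡ σ i)
  representative-covers i with i <? σ i in eq
  ... | yes _ = inj₁ (select-complete below i (≡.cong does eq))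
  ... | no  _ = inj₂ (select-complete below (σ i) (≡.trans (below-σ i) (≡.cong (not ∘ does) eq)))

hasSize-half : ∀ {A : Set} {P : A → Set} {_~_ : A → A → Set} {n}
  (f : Fin n → A) (σ : Fin n → Fin n) →
  (∀ i → σ (σ i) ≡ i) → (∀ i → σ i ≢ i) →
  (∀ i → P (f i)) → (∀ y → P y → ∃ λ i → y ~ f i) →
  (∀ i j → f i ~ f j → j ≡ i ⊎ j ≡ σ i) → (∀ {y} i → y ~ f i → y ~ f (σ i)) →
  HasSize P _~_ (n / 2)
hasSize-half {P = P} {_~_} f σ σσ σ≢ Pf cover fibre partner =
  ≡.subst (HasSize P _~_) (≡.sym n/2≡half) (xs , Pxs , distinct , covers)
  where
  open FixedPointFreeInvolution σ σσ σ≢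
  xs : Vec _ half
  xs = Vec.map f representatives
  xs≡ : ∀ k → lookup xs k ≡ f (lookup representatives k)
  xs≡ k = Vecₚ.lookup-map k f representatives
  Pxs : ∀ k → P (lookup xs k)
  Pxs k rewrite xs≡ k = Pf _
  distinct : ∀ k l → lookup xs k ~ lookup xs l → k ≡ l
  distinct k l e rewrite xs≡ k | xs≡ l with fibre _ _ e
  ... | inj₁ r≡r′ = representative-injective (≡.sym r≡r′)
  ... | inj₂ r′≡σr = contradiction (representative-below l) λ r′<σr′ →
    Finₚ.<-asym (representative-below k)
      (≡.subst₂ _<_ r′≡σr (≡.trans (≡.cong σ r′≡σr) (σσ _)) r′<σr′)
  covers : ∀ y → P y → ∃ λ k → y ~ lookup xs k
  covers y Py with i , y~fi ← cover y Py | representative-covers i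
  ... | inj₁ (k , rk≡i)  = k , ≡.subst (y ~_) (≡.sym (≡.trans (xs≡ k) (≡.cong f rk≡i))) y~fi
  ... | inj₂ (k , rk≡σi) = k , ≡.subst (y ~_) (≡.sym (≡.trans (xs≡ k) (≡.cong f rk≡σi))) (partner i y~fi)

hasSize-resp : ∀ {A : Set} {P Q : A → Set} {_~_ : A → A → Set} {n} →
  (∀ x → P x → Q x) → (∀ x → Q x → P x) → HasSize P _~_ n → HasSize Q _~_ n
hasSize-resp P⇒Q Q⇒P (xs , Pxs , distinct , covers) =
  xs , (λ i → P⇒Q _ (Pxs i)) , distinct , (λ y → covers y ∘ Q⇒P y)

injective⇒surjective : ∀ {n} (f : Fin n → Fin n) → (∀ {i j} → f i ≡ f j → i ≡ j) → ∀ y → ∃ λ i → f i ≡ y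
injective⇒surjective {suc n} f f-inj y with Finₚ.any? (λ i → f i Finₚ.≟ y)
... | yes hit = hit
... | no miss with i , j , i<j , eq ← Finₚ.pigeonhole (ℕₚ.n<1+n n) (λ i → Fin.punchOut {i = y} (miss ∘ (i ,_) ∘ ≡.sym)) =
  contradiction (f-inj (Finₚ.punchOut-injective (miss ∘ (i ,_) ∘ ≡.sym) (miss ∘ (j ,_) ∘ ≡.sym) eq)) (Finₚ.<⇒≢ i<j)

HasCharacteristic2 : CommutativeRing 0ℓ 0ℓ → Set
HasCharacteristic2 R = 1# + 1# ≈ 0#
  where open CommutativeRing R

-- Polynomial identities over a commutative ring with 1 + 1 ≈ 0 are decided by
-- normalising with coefficients in the two-element field Bool (+ is xor, * is ∧).
module Char2RingSolver (R : CommutativeRing 0ℓ 0ℓ) (1+1≈0 : HasCharacteristic2 R) where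

  open CommutativeRing R

  open import Algebra.Properties.Ring ring using (-0#≈0#; +-inverseʳ-unique)
  open import Tactic.RingSolver.Core.AlmostCommutativeRing using (AlmostCommutativeRing; fromCommutativeRing)
  open import Tactic.RingSolver.Core.Expression public using (Expr; Κ; Ι; _⊕_; _⊗_; ⊝_)
  open import Tactic.RingSolver.Core.Expression using (_⊛_; module Eval)
  open import Tactic.RingSolver.Core.Polynomial.Parameters using (Homomorphism)

  ⟦_⟧𝔹 : Bool → Carrier
  ⟦ true  ⟧𝔹 = 1#
  ⟦ false ⟧𝔹 = 0#

  private
    ring′ : AlmostCommutativeRing 0ℓ 0ℓ
    ring′ = fromCommutativeRing R (λ _ → nothing)

    𝔽₂ : RawRing 0ℓ 0ℓ
    𝔽₂ = record { Carrier = Bool ; _≈_ = _≡_ ; _+_ = _xor_ ; _*_ = _∧_ ; -_ = λ x → x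
                ; 0# = false ; 1# = true }

    +-homo : ∀ x y → ⟦ x xor y ⟧𝔹 ≈ ⟦ x ⟧𝔹 + ⟦ y ⟧𝔹
    +-homo true  true  = sym 1+1≈0
    +-homo true  false = sym (+-identityʳ _)
    +-homo false y     = sym (+-identityˡ _)

    *-homo : ∀ x y → ⟦ x ∧ y ⟧𝔹 ≈ ⟦ x ⟧𝔹 * ⟦ y ⟧𝔹
    *-homo true  y = sym (*-identityˡ _)
    *-homo false y = sym (zeroˡ _)

    -‿homo : ∀ x → ⟦ x ⟧𝔹 ≈ - ⟦ x ⟧𝔹
    -‿homo true  = +-inverseʳ-unique 1# 1# 1+1≈0
    -‿homo false = sym -0#≈0#

    homomorphism : Homomorphism 0ℓ 0ℓ 0ℓ 0ℓ
    homomorphism = record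
      { from = record { rawRing = 𝔽₂ ; isZero = not }
      ; to = ring′
      ; morphism = record
        { ⟦_⟧ = ⟦_⟧𝔹 ; +-homo = +-homo ; *-homo = *-homo ; -‿homo = -‿homo
        ; 0-homo = refl ; 1-homo = refl }
      ; Zero-C⟶Zero-R = λ { false _ → refl } }

    open import Tactic.RingSolver.Core.Polynomial.Base (Homomorphism.from homomorphism)
    open import Tactic.RingSolver.Core.Polynomial.Semantics homomorphism renaming (⟦_⟧ to ⟦_⟧ₚ)
    open import Tactic.RingSolver.Core.Polynomial.Homomorphism homomorphism
    open import Algebra.Properties.Semiring.Exp.TCOptimised (AlmostCommutativeRing.semiring ring′)
      using (^-congˡ)

  open Eval (AlmostCommutativeRing.rawRing ring′) ⟦_⟧𝔹 public using (⟦_⟧)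

  private
    normalise : ∀ {n} → Expr Bool n → Poly n
    normalise (Κ x)   = κ x
    normalise (Ι x)   = ι x
    normalise (x ⊕ y) = normalise x ⊞ normalise y
    normalise (x ⊗ y) = normalise x ⊠ normalise y
    normalise (⊝ x)   = ⊟ normalise x
    normalise (x ⊛ i) = normalise x ⊡ i

    ⟦_⇓⟧ : ∀ {n} → Expr Bool n → Vec Carrier n → Carrier
    ⟦ e ⇓⟧ = ⟦ normalise e ⟧ₚ

    correct : ∀ {n} (e : Expr Bool n) ρ → ⟦ e ⇓⟧ ρ ≈ ⟦ e ⟧ ρ
    correct (Κ x)   ρ = κ-hom x ρ
    correct (Ι x)   ρ = ι-hom x ρ
    correct (x ⊕ y) ρ = trans (⊞-hom (normalise x) (normalise y) ρ) (+-cong (correct x ρ) (correct y ρ))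
    correct (x ⊗ y) ρ = trans (⊠-hom (normalise x) (normalise y) ρ) (*-cong (correct x ρ) (correct y ρ))
    correct (⊝ x)   ρ = trans (⊟-hom (normalise x) ρ) (-‿cong (correct x ρ))
    correct (x ⊛ i) ρ = trans (⊡-hom (normalise x) i ρ) (^-congˡ i (correct x ρ))

  open import Relation.Binary.Reflection setoid Ι ⟦_⟧ ⟦_⇓⟧ correct public using (solve; prove)

  infix 4 _⊜_
  _⊜_ : ∀ {n} → Expr Bool n → Expr Bool n → Expr Bool n × Expr Bool n
  _⊜_ = _,_

  𝟘 𝟙 : ∀ {n} → Expr Bool n
  𝟘 = Κ false
  𝟙 = Κ true

  ⟦⟧-cong : ∀ {n} (e : Expr Bool n) {ρ ρ′} → Pointwise _≈_ ρ ρ′ → ⟦ e ⟧ ρ ≈ ⟦ e ⟧ ρ′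
  ⟦⟧-cong (Κ x)   ρ≈ρ′ = refl
  ⟦⟧-cong (Ι x)   ρ≈ρ′ = Pointwise.lookup ρ≈ρ′ x
  ⟦⟧-cong (x ⊕ y) ρ≈ρ′ = +-cong (⟦⟧-cong x ρ≈ρ′) (⟦⟧-cong y ρ≈ρ′)
  ⟦⟧-cong (x ⊗ y) ρ≈ρ′ = *-cong (⟦⟧-cong x ρ≈ρ′) (⟦⟧-cong y ρ≈ρ′)
  ⟦⟧-cong (⊝ x)   ρ≈ρ′ = -‿cong (⟦⟧-cong x ρ≈ρ′)
  ⟦⟧-cong (x ⊛ i) ρ≈ρ′ = ^-congˡ i (⟦⟧-cong x ρ≈ρ′)

module FiniteFieldFacts (F : FiniteField) where
  open FiniteField F
  open import Algebra.Properties.Ring ring using (-‿involutive; -0#≈0#)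
  open import Relation.Binary.Reasoning.Setoid setoid

  private
    index : Carrier → Fin order
    index x = proj₁ (enum-sur x)

    enum-index : ∀ x → enum (index x) ≈ x
    enum-index x = proj₂ (enum-sur x)

  infix 4 _≟_
  _≟_ : ∀ x y → Dec (x ≈ y)
  x ≟ y with index x Finₚ.≟ index y
  ... | yes eq = yes (begin
    x              ≈⟨ enum-index x ⟨
    enum (index x) ≡⟨ ≡.cong enum eq ⟩
    enum (index y) ≈⟨ enum-index y ⟩
    y              ∎)
  ... | no neq = no λ x≈y → neq (enum-inj _ _ (trans (enum-index x) (trans x≈y (sym (enum-index y)))))

  1≉0 : ¬ 1# ≈ 0#
  1≉0 = 0≉1 ∘ sym

  _⁻¹ : ∀ {x} → ¬ x ≈ 0# → Carrier
  x≉0 ⁻¹ = proj₁ (inverse _ x≉0)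

  x⁻¹*x≈1 : ∀ {x} (x≉0 : ¬ x ≈ 0#) → x≉0 ⁻¹ * x ≈ 1#
  x⁻¹*x≈1 x≉0 = trans (*-comm _ _) (proj₂ (inverse _ x≉0))

  x⁻¹≉0 : ∀ {x} (x≉0 : ¬ x ≈ 0#) → ¬ x≉0 ⁻¹ ≈ 0#
  x⁻¹≉0 x≉0 x⁻¹≈0 = 1≉0 (begin
    1#          ≈⟨ x⁻¹*x≈1 x≉0 ⟨
    x≉0 ⁻¹ * _  ≈⟨ *-congʳ x⁻¹≈0 ⟩
    0# * _      ≈⟨ zeroˡ _ ⟩
    0#          ∎)

  x≉0∧x*y≈0⇒y≈0 : ∀ {x y} → ¬ x ≈ 0# → x * y ≈ 0# → y ≈ 0#
  x≉0∧x*y≈0⇒y≈0 {x} {y} x≉0 xy≈0 = begin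
    y                ≈⟨ *-identityˡ y ⟨
    1# * y           ≈⟨ *-congʳ (x⁻¹*x≈1 x≉0) ⟨
    x≉0 ⁻¹ * x * y   ≈⟨ *-assoc _ x y ⟩
    x≉0 ⁻¹ * (x * y) ≈⟨ *-congˡ xy≈0 ⟩
    x≉0 ⁻¹ * 0#      ≈⟨ zeroʳ _ ⟩
    0#               ∎

  x*y≉0 : ∀ {x y} → ¬ x ≈ 0# → ¬ y ≈ 0# → ¬ x * y ≈ 0#
  x*y≉0 x≉0 y≉0 = y≉0 ∘ x≉0∧x*y≈0⇒y≈0 x≉0

  x*y≈0⇒x≈0⊎y≈0 : ∀ {x y} → x * y ≈ 0# → x ≈ 0# ⊎ y ≈ 0#
  x*y≈0⇒x≈0⊎y≈0 {x} xy≈0 with x ≟ 0#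
  ... | yes x≈0 = inj₁ x≈0
  ... | no  x≉0 = inj₂ (x≉0∧x*y≈0⇒y≈0 x≉0 xy≈0)

  q₋₁ : ℕ
  q₋₁ = ℕ.pred order

  order≡1+q₋₁ : order ≡ suc q₋₁
  order≡1+q₋₁ with order | index 0#
  ... | suc _ | _ = ≡.refl

  element : Fin (suc q₋₁) → Carrier
  element = enum ∘ Fin.cast (≡.sym order≡1+q₋₁)

  element-injective : ∀ {i j} → element i ≈ element j → i ≡ j
  element-injective {i} {j} e =
    ≡.trans (≡.sym (Finₚ.cast-involutive order≡1+q₋₁ _ i))
            (≡.trans (≡.cong (Fin.cast order≡1+q₋₁) (enum-inj _ _ e)) (Finₚ.cast-involutive order≡1+q₋₁ _ j))

  element-index : Carrier → Fin (suc q₋₁)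
  element-index x = Fin.cast order≡1+q₋₁ (index x)

  element-surjective : ∀ x → element (element-index x) ≈ x
  element-surjective x = trans (reflexive (≡.cong enum (Finₚ.cast-involutive _ order≡1+q₋₁ (index x))))
                               (enum-index x)

  nonzero : Fin q₋₁ → Carrier
  nonzero = element ∘ Fin.punchIn (element-index 0#)

  nonzero-≉0 : ∀ k → ¬ nonzero k ≈ 0#
  nonzero-≉0 k e = Finₚ.punchInᵢ≢i _ k (element-injective (trans e (sym (element-surjective 0#))))

  nonzero-injective : ∀ {k l} → nonzero k ≈ nonzero l → k ≡ l
  nonzero-injective = Finₚ.punchIn-injective _ _ _ ∘ element-injective

  nonzero-surjective : ∀ x → ¬ x ≈ 0# → ∃ λ k → nonzero k ≈ x
  nonzero-surjective x x≉0 =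
    Fin.punchOut 0≢x , trans (reflexive (≡.cong element (Finₚ.punchIn-punchOut 0≢x))) (element-surjective x)
    where
    0≢x : element-index 0# ≢ element-index x
    0≢x eq = x≉0 (begin
      x                          ≈⟨ element-surjective x ⟨
      element (element-index x)  ≡⟨ ≡.cong element eq ⟨
      element (element-index 0#) ≈⟨ element-surjective 0# ⟩
      0#                         ∎)

  -- If 1 + 1 ≉ 0 then x ↦ -x pairs off the q - 1 nonzero elements, so q is odd.
  char2 : 2 ∣ order → 1# + 1# ≈ 0#
  char2 2∣q with 1# + 1# ≟ 0#
  ... | yes 2≈0 = 2≈0
  ... | no  2≉0 = contradiction (≡.subst (2 ∣_) (≡.trans order≡1+q₋₁ (≡.cong suc n≡half+half)) 2∣q) (2∤1+m+m half)
    where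
    -x≉0 : ∀ {x} → ¬ x ≈ 0# → ¬ - x ≈ 0#
    -x≉0 x≉0 -x≈0 = x≉0 (trans (sym (-‿involutive _)) (trans (-‿cong -x≈0) -0#≈0#))
    negate : Fin q₋₁ → Fin q₋₁
    negate k = proj₁ (nonzero-surjective (- nonzero k) (-x≉0 (nonzero-≉0 k)))
    nonzero-negate : ∀ k → nonzero (negate k) ≈ - nonzero k
    nonzero-negate k = proj₂ (nonzero-surjective (- nonzero k) (-x≉0 (nonzero-≉0 k)))
    negate-involutive : ∀ k → negate (negate k) ≡ k
    negate-involutive k = nonzero-injective (begin
      nonzero (negate (negate k)) ≈⟨ nonzero-negate (negate k) ⟩
      - nonzero (negate k)        ≈⟨ -‿cong (nonzero-negate k) ⟩
      - - nonzero k               ≈⟨ -‿involutive _ ⟩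
      nonzero k                   ∎)
    negate-fixpointFree : ∀ k → negate k ≢ k
    negate-fixpointFree k eq = nonzero-≉0 k (x≉0∧x*y≈0⇒y≈0 2≉0 (begin
      (1# + 1#) * x      ≈⟨ distribʳ x 1# 1# ⟩
      1# * x + 1# * x    ≈⟨ +-cong (*-identityˡ x) (*-identityˡ x) ⟩
      x + x              ≈⟨ +-congˡ (trans (reflexive (≡.cong nonzero (≡.sym eq))) (nonzero-negate k)) ⟩
      x + - x            ≈⟨ -‿inverseʳ x ⟩
      0#                 ∎))
      where
      x : Carrier
      x = nonzero k
    open FixedPointFreeInvolution negate negate-involutive negate-fixpointFree

module Char2Geometry (F : FiniteField) (1+1≈0 : HasCharacteristic2 (FiniteField.commRing F)) where
  open Geometry F
  open FiniteFieldFacts F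
  open Char2RingSolver commRing 1+1≈0
  module ≈-Reasoning = Relation.Binary.Reasoning.Setoid setoid

  x+x≈0 : ∀ x → x + x ≈ 0#
  x+x≈0 = solve 1 (λ x → x ⊕ x ⊜ 𝟘) refl

  x+y≈0⇒x≈y : ∀ {x y} → x + y ≈ 0# → x ≈ y
  x+y≈0⇒x≈y {x} {y} x+y≈0 = begin
    x            ≈⟨ solve 2 (λ x y → x ⊜ (x ⊕ y) ⊕ y) refl x y ⟩
    (x + y) + y  ≈⟨ +-congʳ x+y≈0 ⟩
    0# + y       ≈⟨ +-identityˡ y ⟩
    y            ∎
    where open ≈-Reasoning

  x≈0∧y≈0⇒x+y≈0 : ∀ {x y} → x ≈ 0# → y ≈ 0# → x + y ≈ 0#
  x≈0∧y≈0⇒x+y≈0 x≈0 y≈0 = trans (+-cong x≈0 y≈0) (+-identityʳ 0#)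

  y≈0⇒x*y≈0 : ∀ {x y} → y ≈ 0# → x * y ≈ 0#
  y≈0⇒x*y≈0 y≈0 = trans (*-congˡ y≈0) (zeroʳ _)

  x*x≈0⇒x≈0 : ∀ {x} → x * x ≈ 0# → x ≈ 0#
  x*x≈0⇒x≈0 x²≈0 with x*y≈0⇒x≈0⊎y≈0 x²≈0
  ... | inj₁ x≈0 = x≈0
  ... | inj₂ x≈0 = x≈0

  x≉0∧x*y²≈0⇒y≈0 : ∀ {x y} → ¬ x ≈ 0# → x * (y * y) ≈ 0# → y ≈ 0#
  x≉0∧x*y²≈0⇒y≈0 x≉0 = x*x≈0⇒x≈0 ∘ x≉0∧x*y≈0⇒y≈0 x≉0

  -- Squaring is additive in characteristic 2, hence injective.
  x²≈y²⇒x≈y : ∀ {x y} → x * x ≈ y * y → x ≈ y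
  x²≈y²⇒x≈y {x} {y} x²≈y² = x+y≈0⇒x≈y (x*x≈0⇒x≈0 (begin
    (x + y) * (x + y)  ≈⟨ solve 2 (λ x y → (x ⊕ y) ⊗ (x ⊕ y) ⊜ x ⊗ x ⊕ y ⊗ y) refl x y ⟩
    x * x + y * y      ≈⟨ +-congʳ x²≈y² ⟩
    y * y + y * y      ≈⟨ x+x≈0 (y * y) ⟩
    0#                 ∎))
    where open ≈-Reasoning

  square-root : ∀ x → ∃ λ s → s * s ≈ x
  square-root x = element i , (begin
    element i * element i      ≈⟨ element-surjective _ ⟨
    element (square i)         ≡⟨ ≡.cong element (proj₂ preimage) ⟩
    element (element-index x)  ≈⟨ element-surjective x ⟩
    x                          ∎)
    where
    open ≈-Reasoning
    square : Fin (suc q₋₁) → Fin (suc q₋₁)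
    square i = element-index (element i * element i)
    square-injective : ∀ {i j} → square i ≡ square j → i ≡ j
    square-injective {i} {j} eq = element-injective (x²≈y²⇒x≈y (begin
      element i * element i   ≈⟨ element-surjective _ ⟨
      element (square i)      ≡⟨ ≡.cong element eq ⟩
      element (square j)      ≈⟨ element-surjective _ ⟩
      element j * element j   ∎))
    preimage : ∃ λ i → square i ≡ element-index x
    preimage = injective⇒surjective square square-injective (element-index x)
    i : Fin (suc q₋₁)
    i = proj₁ preimage

  -- Points and lines of PG(3, q)

  infix 4 _≈ᵥ_
  _≈ᵥ_ : V4 → V4 → Set
  u ≈ᵥ v = ∀ i → u i ≈ v i

  ·-congʳ : ∀ {u u′} (N : Mat4) → u ≈ᵥ u′ → u · N ≈ᵥ u′ · N
  ·-congʳ N u≈u′ j = +-cong (+-cong (+-cong (*-congʳ (u≈u′ i0)) (*-congʳ (u≈u′ i1)))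
                                     (*-congʳ (u≈u′ i2))) (*-congʳ (u≈u′ i3))

  ·-congˡ : ∀ u {N N′ : Mat4} → (∀ i j → N i j ≈ N′ i j) → u · N ≈ᵥ u · N′
  ·-congˡ u N≈N′ j = +-cong (+-cong (+-cong (*-congˡ (N≈N′ i0 j)) (*-congˡ (N≈N′ i1 j)))
                                     (*-congˡ (N≈N′ i2 j))) (*-congˡ (N≈N′ i3 j))

  inSpan-left : ∀ u v → InSpan (u , v) u
  inSpan-left u v = 1# , 0# , λ i → solve 2 (λ x y → x ⊜ 𝟙 ⊗ x ⊕ 𝟘 ⊗ y) refl (u i) (v i)

  inSpan-right : ∀ u v → InSpan (u , v) v
  inSpan-right u v = 0# , 1# , λ i → solve 2 (λ x y → y ⊜ 𝟘 ⊗ x ⊕ 𝟙 ⊗ y) refl (u i) (v i)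

  inSpan-resp : ∀ {L w w′} → w ≈ᵥ w′ → InSpan L w → InSpan L w′
  inSpan-resp {u , v} w≈w′ (α , β , w≈) = α , β , λ i → trans (sym (w≈w′ i)) (w≈ i)

  inSpan-trans : ∀ {u v w₁ w₂ x} →
    InSpan (u , v) w₁ → InSpan (u , v) w₂ → InSpan (w₁ , w₂) x → InSpan (u , v) x
  inSpan-trans {u} {v} (α₁ , β₁ , w₁≈) (α₂ , β₂ , w₂≈) (γ , δ , x≈) =
    γ * α₁ + δ * α₂ , γ * β₁ + δ * β₂ , λ i → trans (x≈ i) (begin
      γ * _ + δ * _                                         ≈⟨ +-cong (*-congˡ (w₁≈ i)) (*-congˡ (w₂≈ i)) ⟩
      γ * (α₁ * u i + β₁ * v i) + δ * (α₂ * u i + β₂ * v i) ≈⟨ combine γ δ α₁ β₁ α₂ β₂ (u i) (v i) ⟩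
      (γ * α₁ + δ * α₂) * u i + (γ * β₁ + δ * β₂) * v i     ∎)
    where
    open ≈-Reasoning
    combine : ∀ γ δ α₁ β₁ α₂ β₂ x y →
      γ * (α₁ * x + β₁ * y) + δ * (α₂ * x + β₂ * y) ≈ (γ * α₁ + δ * α₂) * x + (γ * β₁ + δ * β₂) * y
    combine = solve 8 (λ γ δ α₁ β₁ α₂ β₂ x y →
      γ ⊗ (α₁ ⊗ x ⊕ β₁ ⊗ y) ⊕ δ ⊗ (α₂ ⊗ x ⊕ β₂ ⊗ y) ⊜ (γ ⊗ α₁ ⊕ δ ⊗ α₂) ⊗ x ⊕ (γ ⊗ β₁ ⊕ δ ⊗ β₂) ⊗ y) refl

  ·-linear : ∀ α β (u v : V4) (N : Mat4) j →
    ((λ i → α * u i + β * v i) · N) j ≈ α * (u · N) j + β * (v · N) j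
  ·-linear α β u v N j = linear α β (u i0) (u i1) (u i2) (u i3) (v i0) (v i1) (v i2) (v i3)
                                    (N i0 j) (N i1 j) (N i2 j) (N i3 j)
    where
    linear : ∀ α β u₀ u₁ u₂ u₃ v₀ v₁ v₂ v₃ n₀ n₁ n₂ n₃ →
      (α * u₀ + β * v₀) * n₀ + (α * u₁ + β * v₁) * n₁ + (α * u₂ + β * v₂) * n₂ + (α * u₃ + β * v₃) * n₃ ≈
      α * (u₀ * n₀ + u₁ * n₁ + u₂ * n₂ + u₃ * n₃) + β * (v₀ * n₀ + v₁ * n₁ + v₂ * n₂ + v₃ * n₃)
    linear = solve 14 (λ α β u₀ u₁ u₂ u₃ v₀ v₁ v₂ v₃ n₀ n₁ n₂ n₃ →
      (α ⊗ u₀ ⊕ β ⊗ v₀) ⊗ n₀ ⊕ (α ⊗ u₁ ⊕ β ⊗ v₁) ⊗ n₁ ⊕ (α ⊗ u₂ ⊕ β ⊗ v₂) ⊗ n₂ ⊕ (α ⊗ u₃ ⊕ β ⊗ v₃) ⊗ n₃ ⊜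
      α ⊗ (u₀ ⊗ n₀ ⊕ u₁ ⊗ n₁ ⊕ u₂ ⊗ n₂ ⊕ u₃ ⊗ n₃) ⊕ β ⊗ (v₀ ⊗ n₀ ⊕ v₁ ⊗ n₁ ⊕ v₂ ⊗ n₂ ⊕ v₃ ⊗ n₃)) refl

  inSpan-· : ∀ {u v w} (N : Mat4) → InSpan (u , v) w → InSpan (u · N , v · N) (w · N)
  inSpan-· {u} {v} N (α , β , w≈) = α , β , λ j → trans (·-congʳ N w≈ j) (·-linear α β u v N j)

  SameLine-refl : ∀ {L} → SameLine L L
  SameLine-refl {u , v} = inSpan-left u v , inSpan-right u v , inSpan-left u v , inSpan-right u v

  SameLine-sym : ∀ {L L′} → SameLine L L′ → SameLine L′ L
  SameLine-sym {_ , _} {_ , _} (u′∈L , v′∈L , u∈L′ , v∈L′) = u∈L′ , v∈L′ , u′∈L , v′∈L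

  SameLine-trans : ∀ {L L′ L″} → SameLine L L′ → SameLine L′ L″ → SameLine L L″
  SameLine-trans {_ , _} {_ , _} {_ , _} (u′∈L , v′∈L , u∈L′ , v∈L′) (u″∈L′ , v″∈L′ , u′∈L″ , v′∈L″) =
    inSpan-trans u′∈L v′∈L u″∈L′ , inSpan-trans u′∈L v′∈L v″∈L′ ,
    inSpan-trans u′∈L″ v′∈L″ u∈L′ , inSpan-trans u′∈L″ v′∈L″ v∈L′

  lineSetoid : Setoid 0ℓ 0ℓ
  lineSetoid = record
    { Carrier = Line ; _≈_ = SameLine
    ; isEquivalence = record { refl = SameLine-refl ; sym = SameLine-sym ; trans = SameLine-trans } }

  module LineReasoning = Relation.Binary.Reasoning.Setoid lineSetoid

  SameLine-swap : ∀ u v → SameLine (u , v) (v , u)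
  SameLine-swap u v = inSpan-right u v , inSpan-left u v , inSpan-right v u , inSpan-left v u

  SameLine-pointwise : ∀ {u v u′ v′} → u ≈ᵥ u′ → v ≈ᵥ v′ → SameLine (u , v) (u′ , v′)
  SameLine-pointwise {u} {v} {u′} {v′} u≈u′ v≈v′ =
    inSpan-resp u≈u′ (inSpan-left u v) , inSpan-resp v≈v′ (inSpan-right u v) ,
    inSpan-resp (sym ∘ u≈u′) (inSpan-left u′ v′) , inSpan-resp (sym ∘ v≈v′) (inSpan-right u′ v′)

  SameLine-· : ∀ {L L′} (N : Mat4) → SameLine L L′ → SameLine (L ·ᴸ N) (L′ ·ᴸ N)
  SameLine-· {_ , _} {_ , _} N (u′∈L , v′∈L , u∈L′ , v∈L′) =
    inSpan-· N u′∈L , inSpan-· N v′∈L , inSpan-· N u∈L′ , inSpan-· N v∈L′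

  SamePoint⇒SameLine : ∀ {u v u′ v′} → SamePoint u u′ → SamePoint v v′ → SameLine (u , v) (u′ , v′)
  SamePoint⇒SameLine {u} {v} {u′} {v′} (κ , κ≉0 , u′≈κu) (λ′ , λ′≉0 , v′≈λ′v) =
    (κ , 0# , λ i → trans (u′≈κu i) (solve 3 (λ κ x y → κ ⊗ x ⊜ κ ⊗ x ⊕ 𝟘 ⊗ y) refl κ (u i) (v i))) ,
    (0# , λ′ , λ i → trans (v′≈λ′v i) (solve 3 (λ λ′ x y → λ′ ⊗ y ⊜ 𝟘 ⊗ x ⊕ λ′ ⊗ y) refl λ′ (u i) (v i))) ,
    (κ≉0 ⁻¹ , 0# , λ i → sym (trans (+-cong (descale κ≉0 (u′≈κu i)) (zeroˡ _)) (+-identityʳ _))) ,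
    (0# , λ′≉0 ⁻¹ , λ i → sym (trans (+-cong (zeroˡ _) (descale λ′≉0 (v′≈λ′v i))) (+-identityˡ _)))
    where
    descale : ∀ {κ x y} (κ≉0 : ¬ κ ≈ 0#) → y ≈ κ * x → κ≉0 ⁻¹ * y ≈ x
    descale {κ} {x} κ≉0 y≈κx =
      trans (*-congˡ y≈κx) (trans (sym (*-assoc _ κ x)) (trans (*-congʳ (x⁻¹*x≈1 κ≉0)) (*-identityˡ x)))

  SameProj⇒SameLine : ∀ L {N N′} → SameProj N N′ → SameLine (L ·ᴸ N) (L ·ᴸ N′)
  SameProj⇒SameLine (u , v) {N} {N′} (λ′ , λ′≉0 , N′≈λ′N) =
    SamePoint⇒SameLine (λ′ , λ′≉0 , scaled u) (λ′ , λ′≉0 , scaled v)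
    where
    scaled : ∀ x j → (x · N′) j ≈ λ′ * (x · N) j
    scaled x j = trans (·-congˡ x N′≈λ′N j)
      (solve 9 (λ λ′ x₀ x₁ x₂ x₃ n₀ n₁ n₂ n₃ →
         x₀ ⊗ (λ′ ⊗ n₀) ⊕ x₁ ⊗ (λ′ ⊗ n₁) ⊕ x₂ ⊗ (λ′ ⊗ n₂) ⊕ x₃ ⊗ (λ′ ⊗ n₃) ⊜
         λ′ ⊗ (x₀ ⊗ n₀ ⊕ x₁ ⊗ n₁ ⊕ x₂ ⊗ n₂ ⊕ x₃ ⊗ n₃)) refl
       λ′ (x i0) (x i1) (x i2) (x i3) (N i0 j) (N i1 j) (N i2 j) (N i3 j))

  ≈⇒SameProj : ∀ {N N′ : Mat4} → (∀ i j → N i j ≈ N′ i j) → SameProj N N′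
  ≈⇒SameProj N≈N′ = 1# , 1≉0 , λ i j → trans (sym (N≈N′ i j)) (sym (*-identityˡ _))

  SameProj-trans : ∀ {N N′ N″} → SameProj N N′ → SameProj N′ N″ → SameProj N N″
  SameProj-trans (λ′ , λ′≉0 , N′≈) (λ″ , λ″≉0 , N″≈) =
    λ″ * λ′ , x*y≉0 λ″≉0 λ′≉0 , λ i j → trans (N″≈ i j) (trans (*-congˡ (N′≈ i j)) (sym (*-assoc _ _ _)))

  -- The group G_q modulo scalars

  open GElt

  -- GElt (a, b, c, d) stands for the 2 × 2 matrix with rows (a, c) and (b, d); _∘G_ is the matrix product.
  infixl 7 _∘G_
  _∘G_ : GElt → GElt → GElt
  gelt a b c d Δ≉0 ∘G gelt e f g h Δ′≉0 =
    gelt (a * e + c * f) (b * e + d * f) (a * g + c * h) (b * g + d * h)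
         (λ Δ″≈0 → x*y≉0 Δ≉0 Δ′≉0 (trans (sym (det-∘ a b c d e f g h)) Δ″≈0))
    where
    det-∘ : ∀ a b c d e f g h → (a * e + c * f) * (b * g + d * h) - (b * e + d * f) * (a * g + c * h) ≈
                                (a * d - b * c) * (e * h - f * g)
    det-∘ = solve 8 (λ a b c d e f g h →
      (a ⊗ e ⊕ c ⊗ f) ⊗ (b ⊗ g ⊕ d ⊗ h) ⊕ ⊝ ((b ⊗ e ⊕ d ⊗ f) ⊗ (a ⊗ g ⊕ c ⊗ h)) ⊜
      (a ⊗ d ⊕ ⊝ (b ⊗ c)) ⊗ (e ⊗ h ⊕ ⊝ (f ⊗ g))) refl

  idG : GElt
  idG = gelt 1# 0# 0# 1# (1≉0 ∘ trans (sym (solve 0 (𝟙 ⊗ 𝟙 ⊕ ⊝ (𝟘 ⊗ 𝟘) ⊜ 𝟙) refl)))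

  -- In characteristic 2 the adjugate of the 2 × 2 matrix needs no signs.
  adjoint : GElt → GElt
  adjoint (gelt a b c d Δ≉0) = gelt d b c a (Δ≉0 ∘ trans (solve 4 (λ a b c d →
    a ⊗ d ⊕ ⊝ (b ⊗ c) ⊜ d ⊗ a ⊕ ⊝ (b ⊗ c)) refl a b c d))

  infix 4 _∼_
  record _∼_ (g h : GElt) : Set where
    constructor proportional
    field
      factor   : Carrier
      factor≉0 : ¬ factor ≈ 0#
      a≈       : a h ≈ factor * a g
      b≈       : b h ≈ factor * b g
      c≈       : c h ≈ factor * c g
      d≈       : d h ≈ factor * d g

  ≈⇒∼ : ∀ {g h} → a g ≈ a h → b g ≈ b h → c g ≈ c h → d g ≈ d h → g ∼ h
  ≈⇒∼ a≈ b≈ c≈ d≈ = proportional 1# 1≉0 (by a≈) (by b≈) (by c≈) (by d≈)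
    where
    by : ∀ {x y} → x ≈ y → y ≈ 1# * x
    by x≈y = trans (sym x≈y) (sym (*-identityˡ _))

  ∼-refl : ∀ {g} → g ∼ g
  ∼-refl = ≈⇒∼ refl refl refl refl

  ∼-sym : ∀ {g h} → g ∼ h → h ∼ g
  ∼-sym (proportional κ κ≉0 a≈ b≈ c≈ d≈) =
    proportional (κ≉0 ⁻¹) (x⁻¹≉0 κ≉0) (unscale a≈) (unscale b≈) (unscale c≈) (unscale d≈)
    where
    unscale : ∀ {x y} → y ≈ κ * x → x ≈ κ≉0 ⁻¹ * y
    unscale {x} {y} y≈κx = sym (begin
      κ≉0 ⁻¹ * y        ≈⟨ *-congˡ y≈κx ⟩
      κ≉0 ⁻¹ * (κ * x)  ≈⟨ *-assoc _ κ x ⟨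
      κ≉0 ⁻¹ * κ * x    ≈⟨ *-congʳ (x⁻¹*x≈1 κ≉0) ⟩
      1# * x            ≈⟨ *-identityˡ x ⟩
      x                 ∎)
      where open ≈-Reasoning

  ∼-trans : ∀ {g h k} → g ∼ h → h ∼ k → g ∼ k
  ∼-trans (proportional κ κ≉0 a≈ b≈ c≈ d≈) (proportional κ′ κ′≉0 a≈′ b≈′ c≈′ d≈′) =
    proportional (κ′ * κ) (x*y≉0 κ′≉0 κ≉0) (rescale a≈′ a≈) (rescale b≈′ b≈) (rescale c≈′ c≈) (rescale d≈′ d≈)
    where
    rescale : ∀ {x y z} → z ≈ κ′ * y → y ≈ κ * x → z ≈ κ′ * κ * x
    rescale z≈ y≈ = trans z≈ (trans (*-congˡ y≈) (sym (*-assoc _ _ _)))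

  ∼-setoid : Setoid 0ℓ 0ℓ
  ∼-setoid = record
    { Carrier = GElt ; _≈_ = _∼_
    ; isEquivalence = record { refl = ∼-refl ; sym = ∼-sym ; trans = ∼-trans } }

  module ∼-Reasoning = Relation.Binary.Reasoning.Setoid ∼-setoid

  ∘G-cong : ∀ {g g′ h h′} → g ∼ g′ → h ∼ h′ → g ∘G h ∼ g′ ∘G h′
  ∘G-cong {gelt a b c d _} {gelt _ _ _ _ _} {gelt e f g h _} {gelt _ _ _ _ _}
          (proportional κ κ≉0 a≈ b≈ c≈ d≈) (proportional λ′ λ′≉0 e≈ f≈ g≈ h≈) =
    proportional (κ * λ′) (x*y≉0 κ≉0 λ′≉0)
      (trans (+-cong (*-cong a≈ e≈) (*-cong c≈ f≈)) (bilinear a e c f))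
      (trans (+-cong (*-cong b≈ e≈) (*-cong d≈ f≈)) (bilinear b e d f))
      (trans (+-cong (*-cong a≈ g≈) (*-cong c≈ h≈)) (bilinear a g c h))
      (trans (+-cong (*-cong b≈ g≈) (*-cong d≈ h≈)) (bilinear b g d h))
    where
    bilinear : ∀ x y z w → κ * x * (λ′ * y) + κ * z * (λ′ * w) ≈ κ * λ′ * (x * y + z * w)
    bilinear = solve 6 (λ κ λ′ x y z w →
      κ ⊗ x ⊗ (λ′ ⊗ y) ⊕ κ ⊗ z ⊗ (λ′ ⊗ w) ⊜ κ ⊗ λ′ ⊗ (x ⊗ y ⊕ z ⊗ w)) refl κ λ′

  ∘G-congˡ : ∀ g {h h′} → h ∼ h′ → g ∘G h ∼ g ∘G h′
  ∘G-congˡ g = ∘G-cong (∼-refl {g})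

  ∘G-congʳ : ∀ {g g′} h → g ∼ g′ → g ∘G h ∼ g′ ∘G h
  ∘G-congʳ h g∼g′ = ∘G-cong g∼g′ (∼-refl {h})

  ∘G-assoc : ∀ g h k → (g ∘G h) ∘G k ∼ g ∘G (h ∘G k)
  ∘G-assoc (gelt a b c d _) (gelt e f g h _) (gelt i j k l _) =
    ≈⇒∼ (assoc a c i j) (assoc b d i j) (assoc a c k l) (assoc b d k l)
    where
    assoc : ∀ x z i j → (x * e + z * f) * i + (x * g + z * h) * j ≈ x * (e * i + g * j) + z * (f * i + h * j)
    assoc = solve 8 (λ e f g h x z i j →
      (x ⊗ e ⊕ z ⊗ f) ⊗ i ⊕ (x ⊗ g ⊕ z ⊗ h) ⊗ j ⊜ x ⊗ (e ⊗ i ⊕ g ⊗ j) ⊕ z ⊗ (f ⊗ i ⊕ h ⊗ j)) refl e f g h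

  private
    1x+0y≈x : ∀ x y → 1# * x + 0# * y ≈ x
    1x+0y≈x = solve 2 (λ x y → 𝟙 ⊗ x ⊕ 𝟘 ⊗ y ⊜ x) refl

    0x+1y≈y : ∀ x y → 0# * x + 1# * y ≈ y
    0x+1y≈y = solve 2 (λ x y → 𝟘 ⊗ x ⊕ 𝟙 ⊗ y ⊜ y) refl

    x1+y0≈x : ∀ x y → x * 1# + y * 0# ≈ x
    x1+y0≈x = solve 2 (λ x y → x ⊗ 𝟙 ⊕ y ⊗ 𝟘 ⊜ x) refl

    x0+y1≈y : ∀ x y → x * 0# + y * 1# ≈ y
    x0+y1≈y = solve 2 (λ x y → x ⊗ 𝟘 ⊕ y ⊗ 𝟙 ⊜ y) refl

  ∘G-identityˡ : ∀ g → idG ∘G g ∼ g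
  ∘G-identityˡ (gelt a b c d _) = ≈⇒∼ (1x+0y≈x a b) (0x+1y≈y a b) (1x+0y≈x c d) (0x+1y≈y c d)

  ∘G-identityʳ : ∀ g → g ∘G idG ∼ g
  ∘G-identityʳ (gelt a b c d _) = ≈⇒∼ (x1+y0≈x a c) (x1+y0≈x b d) (x0+y1≈y a c) (x0+y1≈y b d)

  adjoint-inverseʳ : ∀ g → idG ∼ g ∘G adjoint g
  adjoint-inverseʳ (gelt a b c d Δ≉0) = proportional (a * d - b * c) Δ≉0
    (solve 4 (λ a b c d → a ⊗ d ⊕ c ⊗ b ⊜ (a ⊗ d ⊕ ⊝ (b ⊗ c)) ⊗ 𝟙) refl a b c d)
    (solve 4 (λ a b c d → b ⊗ d ⊕ d ⊗ b ⊜ (a ⊗ d ⊕ ⊝ (b ⊗ c)) ⊗ 𝟘) refl a b c d)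
    (solve 4 (λ a b c d → a ⊗ c ⊕ c ⊗ a ⊜ (a ⊗ d ⊕ ⊝ (b ⊗ c)) ⊗ 𝟘) refl a b c d)
    (solve 4 (λ a b c d → b ⊗ c ⊕ d ⊗ a ⊜ (a ⊗ d ⊕ ⊝ (b ⊗ c)) ⊗ 𝟙) refl a b c d)

  adjoint-inverseˡ : ∀ g → idG ∼ adjoint g ∘G g
  adjoint-inverseˡ (gelt a b c d Δ≉0) = proportional (a * d - b * c) Δ≉0
    (solve 4 (λ a b c d → d ⊗ a ⊕ c ⊗ b ⊜ (a ⊗ d ⊕ ⊝ (b ⊗ c)) ⊗ 𝟙) refl a b c d)
    (solve 4 (λ a b c d → b ⊗ a ⊕ a ⊗ b ⊜ (a ⊗ d ⊕ ⊝ (b ⊗ c)) ⊗ 𝟘) refl a b c d)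
    (solve 4 (λ a b c d → d ⊗ c ⊕ c ⊗ d ⊜ (a ⊗ d ⊕ ⊝ (b ⊗ c)) ⊗ 𝟘) refl a b c d)
    (solve 4 (λ a b c d → b ⊗ c ⊕ a ⊗ d ⊜ (a ⊗ d ⊕ ⊝ (b ⊗ c)) ⊗ 𝟙) refl a b c d)

  ∘G-cancelʳ : ∀ {g h} k → g ∘G k ∼ h ∘G k → g ∼ h
  ∘G-cancelʳ {g} {h} k gk∼hk = begin
    g                          ≈⟨ ∘G-identityʳ g ⟨
    g ∘G idG                   ≈⟨ ∘G-congˡ g (adjoint-inverseʳ k) ⟩
    g ∘G (k ∘G adjoint k)      ≈⟨ ∘G-assoc g k (adjoint k) ⟨
    (g ∘G k) ∘G adjoint k      ≈⟨ ∘G-congʳ (adjoint k) gk∼hk ⟩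
    (h ∘G k) ∘G adjoint k      ≈⟨ ∘G-assoc h k (adjoint k) ⟩
    h ∘G (k ∘G adjoint k)      ≈⟨ ∘G-congˡ h (adjoint-inverseʳ k) ⟨
    h ∘G idG                   ≈⟨ ∘G-identityʳ h ⟩
    h                          ∎
    where open ∼-Reasoning

  ∼-∘G-adjoint : ∀ {k h} g → k ∼ h ∘G adjoint g → k ∘G g ∼ h
  ∼-∘G-adjoint {k} {h} g k∼hg⁻¹ = begin
    k ∘G g                     ≈⟨ ∘G-congʳ g k∼hg⁻¹ ⟩
    (h ∘G adjoint g) ∘G g      ≈⟨ ∘G-assoc h (adjoint g) g ⟩
    h ∘G (adjoint g ∘G g)      ≈⟨ ∘G-congˡ h (adjoint-inverseˡ g) ⟨
    h ∘G idG                   ≈⟨ ∘G-identityʳ h ⟩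
    h                          ∎
    where open ∼-Reasoning

  -- Syntactic copies of vec, mat, _·_ and M: their semantics ⟦_⟧ computes to the originals,
  -- so that identities between entries can be handed to the solver.
  vecₑ : ∀ {n} (x₀ x₁ x₂ x₃ : Expr Bool n) → Fin 4 → Expr Bool n
  vecₑ x₀ x₁ x₂ x₃ = lookup (x₀ ∷ x₁ ∷ x₂ ∷ x₃ ∷ [])

  matₑ : ∀ {n} → Vec (Vec (Expr Bool n) 4) 4 → Fin 4 → Fin 4 → Expr Bool n
  matₑ rows i j = lookup (lookup rows i) j

  infixl 7 _·ₑ_
  _·ₑ_ : ∀ {n} → (Fin 4 → Expr Bool n) → (Fin 4 → Fin 4 → Expr Bool n) → Fin 4 → Expr Bool n
  (x ·ₑ N) j = x i0 ⊗ N i0 j ⊕ x i1 ⊗ N i1 j ⊕ x i2 ⊗ N i2 j ⊕ x i3 ⊗ N i3 j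

  M-rowsₑ : ∀ {n} (a b c d : Expr Bool n) → Vec (Vec (Expr Bool n) 4) 4
  M-rowsₑ {n} a b c d =
      (a ⊗ a ⊗ a ∷ a ⊗ a ⊗ c ∷ a ⊗ c ⊗ c ∷ c ⊗ c ⊗ c ∷ [])
    ∷ (3ₑ ⊗ a ⊗ a ⊗ b ∷ a ⊗ a ⊗ d ⊕ 2ₑ ⊗ a ⊗ b ⊗ c ∷ b ⊗ c ⊗ c ⊕ 2ₑ ⊗ a ⊗ c ⊗ d ∷ 3ₑ ⊗ c ⊗ c ⊗ d ∷ [])
    ∷ (3ₑ ⊗ a ⊗ b ⊗ b ∷ b ⊗ b ⊗ c ⊕ 2ₑ ⊗ a ⊗ b ⊗ d ∷ a ⊗ d ⊗ d ⊕ 2ₑ ⊗ b ⊗ c ⊗ d ∷ 3ₑ ⊗ c ⊗ d ⊗ d ∷ [])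
    ∷ (b ⊗ b ⊗ b ∷ b ⊗ b ⊗ d ∷ b ⊗ d ⊗ d ∷ d ⊗ d ⊗ d ∷ [])
    ∷ []
    where
    2ₑ 3ₑ : Expr Bool n
    2ₑ = 𝟙 ⊕ 𝟙
    3ₑ = 𝟙 ⊕ 𝟙 ⊕ 𝟙

  Mₑ : ∀ {n} (a b c d : Expr Bool n) → Fin 4 → Fin 4 → Expr Bool n
  Mₑ a b c d = matₑ (M-rowsₑ a b c d)

  coordinates : GElt → Vec Carrier 4
  coordinates g = a g ∷ b g ∷ c g ∷ d g ∷ []

  M-generic : Fin 4 → Fin 4 → Expr Bool 4
  M-generic = Mₑ (Ι 0F) (Ι 1F) (Ι 2F) (Ι 3F)

  M≡⟦M-generic⟧ : ∀ g i j → M g i j ≡ ⟦ M-generic i j ⟧ (coordinates g)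
  M≡⟦M-generic⟧ g i j = ≡.trans (≡.cong (λ row → lookup row j) (Vecₚ.lookup-map i (Vec.map ⟦_⟧ρ) rows))
                                 (Vecₚ.lookup-map j ⟦_⟧ρ (lookup rows i))
    where
    rows : Vec (Vec (Expr Bool 4) 4) 4
    rows = M-rowsₑ (Ι 0F) (Ι 1F) (Ι 2F) (Ι 3F)
    ⟦_⟧ρ : Expr Bool 4 → Carrier
    ⟦ e ⟧ρ = ⟦ e ⟧ (coordinates g)

  private
    homogeneity : Fin 4 → Fin 4 → (κ a b c d : Expr Bool 5) → Expr Bool 5 × Expr Bool 5
    homogeneity i j κ a b c d = Mₑ (κ ⊗ a) (κ ⊗ b) (κ ⊗ c) (κ ⊗ d) i j ⊜ κ ⊗ κ ⊗ κ ⊗ Mₑ a b c d i j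

  M-homogeneous : ∀ i j κ a b c d →
    ⟦ M-generic i j ⟧ (κ * a ∷ κ * b ∷ κ * c ∷ κ * d ∷ []) ≈ κ * κ * κ * ⟦ M-generic i j ⟧ (a ∷ b ∷ c ∷ d ∷ [])
  M-homogeneous 0F 0F = solve 5 (homogeneity 0F 0F) refl
  M-homogeneous 0F 1F = solve 5 (homogeneity 0F 1F) refl
  M-homogeneous 0F 2F = solve 5 (homogeneity 0F 2F) refl
  M-homogeneous 0F 3F = solve 5 (homogeneity 0F 3F) refl
  M-homogeneous 1F 0F = solve 5 (homogeneity 1F 0F) refl
  M-homogeneous 1F 1F = solve 5 (homogeneity 1F 1F) refl
  M-homogeneous 1F 2F = solve 5 (homogeneity 1F 2F) refl
  M-homogeneous 1F 3F = solve 5 (homogeneity 1F 3F) refl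
  M-homogeneous 2F 0F = solve 5 (homogeneity 2F 0F) refl
  M-homogeneous 2F 1F = solve 5 (homogeneity 2F 1F) refl
  M-homogeneous 2F 2F = solve 5 (homogeneity 2F 2F) refl
  M-homogeneous 2F 3F = solve 5 (homogeneity 2F 3F) refl
  M-homogeneous 3F 0F = solve 5 (homogeneity 3F 0F) refl
  M-homogeneous 3F 1F = solve 5 (homogeneity 3F 1F) refl
  M-homogeneous 3F 2F = solve 5 (homogeneity 3F 2F) refl
  M-homogeneous 3F 3F = solve 5 (homogeneity 3F 3F) refl

  ∼⇒≈G : ∀ {g h} → g ∼ h → g ≈G h
  ∼⇒≈G {g} {h} (proportional κ κ≉0 a≈ b≈ c≈ d≈) = κ * κ * κ , x*y≉0 (x*y≉0 κ≉0 κ≉0) κ≉0 , λ i j → begin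
    M h i j                                                           ≡⟨ M≡⟦M-generic⟧ h i j ⟩
    ⟦ M-generic i j ⟧ (coordinates h)                                 ≈⟨ ⟦⟧-cong (M-generic i j) (a≈ ∷ b≈ ∷ c≈ ∷ d≈ ∷ []) ⟩
    ⟦ M-generic i j ⟧ (κ * a g ∷ κ * b g ∷ κ * c g ∷ κ * d g ∷ [])    ≈⟨ M-homogeneous i j κ (a g) (b g) (c g) (d g) ⟩
    κ * κ * κ * ⟦ M-generic i j ⟧ (coordinates g)                     ≡⟨ ≡.cong (κ * κ * κ *_) (M≡⟦M-generic⟧ g i j) ⟨
    κ * κ * κ * M g i j                                               ∎
    where open ≈-Reasoning

  private
    a′ b′ c′ d′ e′ f′ g′ h′ : Expr Bool 12
    a′ = Ι (# 4) ; b′ = Ι (# 5) ; c′ = Ι (# 6) ; d′ = Ι (# 7)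
    e′ = Ι (# 8) ; f′ = Ι (# 9) ; g′ = Ι (# 10) ; h′ = Ι (# 11)

    composition-lhs composition-rhs : Fin 4 → Expr Bool 12
    composition-lhs = (vecₑ (Ι (# 0)) (Ι (# 1)) (Ι (# 2)) (Ι (# 3)) ·ₑ Mₑ a′ b′ c′ d′) ·ₑ Mₑ e′ f′ g′ h′
    composition-rhs = vecₑ (Ι (# 0)) (Ι (# 1)) (Ι (# 2)) (Ι (# 3)) ·ₑ
      Mₑ (a′ ⊗ e′ ⊕ c′ ⊗ f′) (b′ ⊗ e′ ⊕ d′ ⊗ f′) (a′ ⊗ g′ ⊕ c′ ⊗ h′) (b′ ⊗ g′ ⊕ d′ ⊗ h′)

    composition-env : V4 → GElt → GElt → Vec Carrier 12
    composition-env x g h = Vec.tabulate x Vec.++ coordinates g Vec.++ coordinates h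

  ·-M-∘G : ∀ x g h → (x · M g) · M h ≈ᵥ x · M (g ∘G h)
  ·-M-∘G x g h 0F = prove (composition-env x g h) (composition-lhs 0F) (composition-rhs 0F) refl
  ·-M-∘G x g h 1F = prove (composition-env x g h) (composition-lhs 1F) (composition-rhs 1F) refl
  ·-M-∘G x g h 2F = prove (composition-env x g h) (composition-lhs 2F) (composition-rhs 2F) refl
  ·-M-∘G x g h 3F = prove (composition-env x g h) (composition-lhs 3F) (composition-rhs 3F) refl

  ·ᴸ-∘G : ∀ L g h → SameLine ((L ·ᴸ M g) ·ᴸ M h) (L ·ᴸ M (g ∘G h))
  ·ᴸ-∘G (u , v) g h = SameLine-pointwise (·-M-∘G u g h) (·-M-∘G v g h)

  private
    I4ₑ : ∀ {n} → Fin 4 → Fin 4 → Expr Bool n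
    I4ₑ = matₑ ( (𝟙 ∷ 𝟘 ∷ 𝟘 ∷ 𝟘 ∷ []) ∷ (𝟘 ∷ 𝟙 ∷ 𝟘 ∷ 𝟘 ∷ [])
               ∷ (𝟘 ∷ 𝟘 ∷ 𝟙 ∷ 𝟘 ∷ []) ∷ (𝟘 ∷ 𝟘 ∷ 𝟘 ∷ 𝟙 ∷ []) ∷ [])

    identity-entry : Fin 4 → Fin 4 → Expr Bool 0 × Expr Bool 0
    identity-entry i j = Mₑ 𝟙 𝟘 𝟘 𝟙 i j ⊜ I4ₑ i j

    xᵥ : Fin 4 → Expr Bool 4
    xᵥ = vecₑ (Ι 0F) (Ι 1F) (Ι 2F) (Ι 3F)

  M-idG : ∀ i j → M idG i j ≈ I4 i j
  M-idG 0F 0F = solve 0 (identity-entry 0F 0F) refl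
  M-idG 0F 1F = solve 0 (identity-entry 0F 1F) refl
  M-idG 0F 2F = solve 0 (identity-entry 0F 2F) refl
  M-idG 0F 3F = solve 0 (identity-entry 0F 3F) refl
  M-idG 1F 0F = solve 0 (identity-entry 1F 0F) refl
  M-idG 1F 1F = solve 0 (identity-entry 1F 1F) refl
  M-idG 1F 2F = solve 0 (identity-entry 1F 2F) refl
  M-idG 1F 3F = solve 0 (identity-entry 1F 3F) refl
  M-idG 2F 0F = solve 0 (identity-entry 2F 0F) refl
  M-idG 2F 1F = solve 0 (identity-entry 2F 1F) refl
  M-idG 2F 2F = solve 0 (identity-entry 2F 2F) refl
  M-idG 2F 3F = solve 0 (identity-entry 2F 3F) refl
  M-idG 3F 0F = solve 0 (identity-entry 3F 0F) refl
  M-idG 3F 1F = solve 0 (identity-entry 3F 1F) refl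
  M-idG 3F 2F = solve 0 (identity-entry 3F 2F) refl
  M-idG 3F 3F = solve 0 (identity-entry 3F 3F) refl

  ·-I4 : ∀ x → x · I4 ≈ᵥ x
  ·-I4 x 0F = prove (Vec.tabulate x) ((xᵥ ·ₑ I4ₑ) 0F) (xᵥ 0F) refl
  ·-I4 x 1F = prove (Vec.tabulate x) ((xᵥ ·ₑ I4ₑ) 1F) (xᵥ 1F) refl
  ·-I4 x 2F = prove (Vec.tabulate x) ((xᵥ ·ₑ I4ₑ) 2F) (xᵥ 2F) refl
  ·-I4 x 3F = prove (Vec.tabulate x) ((xᵥ ·ₑ I4ₑ) 3F) (xᵥ 3F) refl

  idG-fixes : ∀ L → Fixes L idG
  idG-fixes (u , v) = SameLine-pointwise (fixed u) (fixed v)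
    where
    fixed : ∀ x → x · M idG ≈ᵥ x
    fixed x j = trans (·-congˡ x M-idG j) (·-I4 x j)

  Fixes-∼ : ∀ {L g h} → g ∼ h → Fixes L g → Fixes L h
  Fixes-∼ {L} g∼h L·g≈L = SameLine-trans (SameLine-sym (SameProj⇒SameLine L (∼⇒≈G g∼h))) L·g≈L

  Fixes⇒·ᴸ-∘G : ∀ L f g → Fixes L f → SameLine (L ·ᴸ M (f ∘G g)) (L ·ᴸ M g)
  Fixes⇒·ᴸ-∘G L f g L·f≈L = begin
    L ·ᴸ M (f ∘G g)       ≈⟨ ·ᴸ-∘G L f g ⟨
    (L ·ᴸ M f) ·ᴸ M g     ≈⟨ SameLine-· (M g) L·f≈L ⟩
    L ·ᴸ M g              ∎
    where open LineReasoning

  SameLine-image⇒Fixes : ∀ L g h → SameLine (L ·ᴸ M g) (L ·ᴸ M h) → Fixes L (h ∘G adjoint g)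
  SameLine-image⇒Fixes L g h L·g≈L·h = begin
    L ·ᴸ M (h ∘G adjoint g)        ≈⟨ ·ᴸ-∘G L h (adjoint g) ⟨
    (L ·ᴸ M h) ·ᴸ M (adjoint g)    ≈⟨ SameLine-· (M (adjoint g)) L·g≈L·h ⟨
    (L ·ᴸ M g) ·ᴸ M (adjoint g)    ≈⟨ ·ᴸ-∘G L g (adjoint g) ⟩
    L ·ᴸ M (g ∘G adjoint g)        ≈⟨ Fixes-∼ (adjoint-inverseʳ g) (idG-fixes L) ⟩
    L                              ∎
    where open LineReasoning

  Fixes-resp : ∀ {L L′} g → SameLine L L′ → Fixes L g → Fixes L′ g
  Fixes-resp {L} {L′} g L≈L′ L·g≈L = begin
    L′ ·ᴸ M g   ≈⟨ SameLine-· (M g) L≈L′ ⟨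
    L ·ᴸ M g    ≈⟨ L·g≈L ⟩
    L           ≈⟨ L≈L′ ⟩
    L′          ∎
    where open LineReasoning

  InOrbit-resp : ∀ {L L′} L″ → SameLine L L′ → InOrbit L L″ → InOrbit L′ L″
  InOrbit-resp L″ L≈L′ (g , L·g≈L″) = g , SameLine-trans (SameLine-· (M g) (SameLine-sym L≈L′)) L·g≈L″

  -- Normal forms up to proportionality: (a, b, 0, 1) with a ≠ 0, and (a, a d + k, 1, d) with k ≠ 0.
  Code : Set
  Code = (Fin q₋₁ × Fin (suc q₋₁)) ⊎ ((Fin (suc q₋₁) × Fin (suc q₋₁)) × Fin q₋₁)

  fromCode : Code → GElt
  fromCode (inj₁ (i , j)) = gelt (nonzero i) (element j) 0# 1#
    (nonzero-≉0 i ∘ trans (sym (solve 2 (λ x y → x ⊗ 𝟙 ⊕ ⊝ (y ⊗ 𝟘) ⊜ x) refl (nonzero i) (element j))))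
  fromCode (inj₂ ((i , j) , k)) = gelt (element i) (element i * element j + nonzero k) 1# (element j)
    (nonzero-≉0 k ∘ trans (sym (solve 3 (λ x y z → x ⊗ y ⊕ ⊝ ((x ⊗ y ⊕ z) ⊗ 𝟙) ⊜ z) refl (element i) (element j) (nonzero k))))

  fromCode-injective : ∀ {c c′} → fromCode c ∼ fromCode c′ → c ≡ c′
  fromCode-injective {inj₁ (i , j)} {inj₁ (i′ , j′)} (proportional κ _ a≈ b≈ _ d≈) =
    ≡.cong₂ (λ i j → inj₁ (i , j)) (nonzero-injective (sym (unit a≈))) (element-injective (sym (unit b≈)))
    where
    unit : ∀ {x y} → y ≈ κ * x → y ≈ x
    unit y≈κx = trans y≈κx (trans (*-congʳ (trans (sym (*-identityʳ κ)) (sym d≈))) (*-identityˡ _))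
  fromCode-injective {inj₁ _} {inj₂ _} (proportional κ _ _ _ c≈ _) = contradiction (trans c≈ (zeroʳ κ)) 1≉0
  fromCode-injective {inj₂ _} {inj₁ _} (proportional κ κ≉0 _ _ c≈ _) = contradiction (trans (sym (*-identityʳ κ)) (sym c≈)) κ≉0
  fromCode-injective {inj₂ ((i , j) , k)} {inj₂ ((i′ , j′) , k′)} (proportional κ _ a≈ b≈ c≈ d≈) =
    ≡.cong inj₂ (≡.cong₂ _,_ (≡.cong₂ _,_ (element-injective (sym a≈′)) (element-injective (sym d≈′)))
                            (nonzero-injective (cancel (*-cong a≈′ d≈′) (sym (unit b≈)))))
    where
    unit : ∀ {x y} → y ≈ κ * x → y ≈ x
    unit y≈κx = trans y≈κx (trans (*-congʳ (trans (sym (*-identityʳ κ)) (sym c≈))) (*-identityˡ _))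
    a≈′ : element i′ ≈ element i
    a≈′ = unit a≈
    d≈′ : element j′ ≈ element j
    d≈′ = unit d≈
    cancel : ∀ {x x′ y z} → x′ ≈ x → x + y ≈ x′ + z → y ≈ z
    cancel {x} {x′} {y} {z} x′≈x x+y≈x′+z = x+y≈0⇒x≈y (begin
      y + z              ≈⟨ solve 3 (λ x y z → y ⊕ z ⊜ (x ⊕ y) ⊕ (x ⊕ z)) refl x y z ⟩
      (x + y) + (x + z)  ≈⟨ +-cong x+y≈x′+z (+-congʳ (sym x′≈x)) ⟩
      (x′ + z) + (x′ + z) ≈⟨ x+x≈0 _ ⟩
      0#                 ∎)
      where open ≈-Reasoning

  fromCode-surjective : ∀ g → ∃ λ c → g ∼ fromCode c
  fromCode-surjective (gelt a b c d Δ≉0) with c ≟ 0#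
  ... | yes c≈0 = inj₁ (proj₁ i , proj₁ j) ,
      proportional (d≉0 ⁻¹) (x⁻¹≉0 d≉0) (proj₂ i) (proj₂ j) (sym (y≈0⇒x*y≈0 c≈0)) (sym (x⁻¹*x≈1 d≉0))
    where
    ad≉0 : ¬ a * d ≈ 0#
    ad≉0 ad≈0 = Δ≉0 (trans (solve 4 (λ a b c d → a ⊗ d ⊕ ⊝ (b ⊗ c) ⊜ a ⊗ d ⊕ b ⊗ c) refl a b c d)
                           (x≈0∧y≈0⇒x+y≈0 ad≈0 (y≈0⇒x*y≈0 c≈0)))
    d≉0 : ¬ d ≈ 0#
    d≉0 d≈0 = ad≉0 (y≈0⇒x*y≈0 d≈0)
    a≉0 : ¬ a ≈ 0#
    a≉0 a≈0 = ad≉0 (trans (*-comm a d) (y≈0⇒x*y≈0 a≈0))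
    i : ∃ λ i → nonzero i ≈ d≉0 ⁻¹ * a
    i = nonzero-surjective (d≉0 ⁻¹ * a) (x*y≉0 (x⁻¹≉0 d≉0) a≉0)
    j : ∃ λ j → element j ≈ d≉0 ⁻¹ * b
    j = element-index (d≉0 ⁻¹ * b) , element-surjective _
  ... | no c≉0 = inj₂ ((element-index (γ * a) , element-index (γ * d)) , proj₁ k) ,
      proportional γ (x⁻¹≉0 c≉0) (element-surjective _) b≈ (sym (x⁻¹*x≈1 c≉0)) (element-surjective _)
    where
    γ : Carrier
    γ = c≉0 ⁻¹
    γ²Δ : γ * γ * (a * d - b * c) ≈ γ * b + (γ * a) * (γ * d)
    γ²Δ = trans (solve 5 (λ γ a b c d → γ ⊗ γ ⊗ (a ⊗ d ⊕ ⊝ (b ⊗ c)) ⊜ γ ⊗ b ⊗ (γ ⊗ c) ⊕ (γ ⊗ a) ⊗ (γ ⊗ d)) refl γ a b c d)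
                (+-congʳ (trans (*-congˡ (x⁻¹*x≈1 c≉0)) (*-identityʳ _)))
    k : ∃ λ k → nonzero k ≈ γ * b + (γ * a) * (γ * d)
    k = nonzero-surjective (γ * b + (γ * a) * (γ * d))
          (x*y≉0 (x*y≉0 (x⁻¹≉0 c≉0) (x⁻¹≉0 c≉0)) Δ≉0 ∘ trans γ²Δ)
    b≈ : element (element-index (γ * a)) * element (element-index (γ * d)) + nonzero (proj₁ k) ≈ γ * b
    b≈ = trans (+-cong (*-cong (element-surjective _) (element-surjective _)) (proj₂ k))
               (solve 2 (λ x y → x ⊕ (y ⊕ x) ⊜ y) refl ((γ * a) * (γ * d)) (γ * b))

  |G| : ℕ
  |G| = q₋₁ ℕ.* suc q₋₁ ℕ.+ suc q₋₁ ℕ.* suc q₋₁ ℕ.* q₋₁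

  codes : Fin |G| ↔ Code
  codes = ↔-trans Finₚ.+↔⊎ (Finₚ.*↔× ⊎-↔ ↔-trans Finₚ.*↔× (Finₚ.*↔× ×-↔ ↔-refl))

  representative : Fin |G| → GElt
  representative = fromCode ∘ Inverse.to codes

  representative-injective : ∀ {x y} → representative x ∼ representative y → x ≡ y
  representative-injective {x} {y} rx∼ry = begin
    x                                         ≡⟨ Inverse.strictlyInverseʳ codes x ⟨
    Inverse.from codes (Inverse.to codes x)   ≡⟨ ≡.cong (Inverse.from codes) (fromCode-injective rx∼ry) ⟩
    Inverse.from codes (Inverse.to codes y)   ≡⟨ Inverse.strictlyInverseʳ codes y ⟩
    y                                         ∎
    where open ≡.≡-Reasoning

  representative-surjective : ∀ g → ∃ λ x → g ∼ representative x
  representative-surjective g with c , g∼c ← fromCode-surjective g =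
    Inverse.from codes c , ≡.subst (λ c → g ∼ fromCode c) (≡.sym (Inverse.strictlyInverseˡ codes c)) g∼c

  -- The lines ℓ_μ

  private
    Ψₑ : ∀ {n} (μ s t : Expr Bool n) → Fin 4 → Fin 4 → Expr Bool n
    Ψₑ μ s t = matₑ ( (𝟘 ∷ 𝟘 ∷ 𝟘 ∷ 𝟙 ∷ []) ∷ (𝟘 ∷ 𝟘 ∷ s ∷ 𝟘 ∷ [])
                    ∷ (𝟘 ∷ μ ∷ 𝟘 ∷ 𝟘 ∷ []) ∷ (t ∷ 𝟘 ∷ 𝟘 ∷ 𝟘 ∷ []) ∷ [])

    R∞ₑ : ∀ {n} → Fin 4 → Expr Bool n
    R∞ₑ = vecₑ 𝟙 𝟘 𝟙 𝟘

  R∞·Ψ : ∀ μ s t → R∞ · Ψ μ s t ≈ᵥ R0 μ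
  R∞·Ψ μ s t 0F = solve 3 (λ μ s t → (R∞ₑ ·ₑ Ψₑ μ s t) 0F ⊜ vecₑ 𝟘 μ 𝟘 𝟙 0F) refl μ s t
  R∞·Ψ μ s t 1F = solve 3 (λ μ s t → (R∞ₑ ·ₑ Ψₑ μ s t) 1F ⊜ vecₑ 𝟘 μ 𝟘 𝟙 1F) refl μ s t
  R∞·Ψ μ s t 2F = solve 3 (λ μ s t → (R∞ₑ ·ₑ Ψₑ μ s t) 2F ⊜ vecₑ 𝟘 μ 𝟘 𝟙 2F) refl μ s t
  R∞·Ψ μ s t 3F = solve 3 (λ μ s t → (R∞ₑ ·ₑ Ψₑ μ s t) 3F ⊜ vecₑ 𝟘 μ 𝟘 𝟙 3F) refl μ s t

  R0·Ψ : ∀ μ s t → R0 μ · Ψ μ s t ≈ᵥ vec t 0# (μ * s) 0#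
  R0·Ψ μ s t 0F = solve 3 (λ μ s t → (vecₑ 𝟘 μ 𝟘 𝟙 ·ₑ Ψₑ μ s t) 0F ⊜ vecₑ t 𝟘 (μ ⊗ s) 𝟘 0F) refl μ s t
  R0·Ψ μ s t 1F = solve 3 (λ μ s t → (vecₑ 𝟘 μ 𝟘 𝟙 ·ₑ Ψₑ μ s t) 1F ⊜ vecₑ t 𝟘 (μ ⊗ s) 𝟘 1F) refl μ s t
  R0·Ψ μ s t 2F = solve 3 (λ μ s t → (vecₑ 𝟘 μ 𝟘 𝟙 ·ₑ Ψₑ μ s t) 2F ⊜ vecₑ t 𝟘 (μ ⊗ s) 𝟘 2F) refl μ s t
  R0·Ψ μ s t 3F = solve 3 (λ μ s t → (vecₑ 𝟘 μ 𝟘 𝟙 ·ₑ Ψₑ μ s t) 3F ⊜ vecₑ t 𝟘 (μ ⊗ s) 𝟘 3F) refl μ s t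

  R∞·Ψ∼R0 : ∀ μ s t → SamePoint (R∞ · Ψ μ s t) (R0 μ)
  R∞·Ψ∼R0 μ s t = 1# , 1≉0 , λ i → trans (sym (R∞·Ψ μ s t i)) (sym (*-identityˡ _))

  R0·Ψ∼R∞ : ∀ {μ s t} → t ≈ μ * s → ¬ t ≈ 0# → SamePoint (R0 μ · Ψ μ s t) R∞
  R0·Ψ∼R∞ {μ} {s} {t} t≈μs t≉0 = t≉0 ⁻¹ , x⁻¹≉0 t≉0 , λ i → trans (rescaled i) (sym (*-congˡ (R0·Ψ μ s t i)))
    where
    rescaled : ∀ i → R∞ i ≈ t≉0 ⁻¹ * vec t 0# (μ * s) 0# i
    rescaled 0F = sym (x⁻¹*x≈1 t≉0)
    rescaled 1F = sym (zeroʳ _)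
    rescaled 2F = sym (trans (*-congˡ (sym t≈μs)) (x⁻¹*x≈1 t≉0))
    rescaled 3F = sym (zeroʳ _)

  Ψ-fixes-ℓ : ∀ {μ s t} → t ≈ μ * s → ¬ t ≈ 0# → SameLine (ℓ μ ·ᴸ Ψ μ s t) (ℓ μ)
  Ψ-fixes-ℓ {μ} {s} {t} t≈μs t≉0 =
    SameLine-trans (SamePoint⇒SameLine (R0·Ψ∼R∞ t≈μs t≉0) (R∞·Ψ∼R0 μ s t)) (SameLine-swap R∞ (R0 μ))

  Ψ-cong : ∀ {μ μ′ s s′ t t′} → μ ≈ μ′ → s ≈ s′ → t ≈ t′ → ∀ i j → Ψ μ s t i j ≈ Ψ μ′ s′ t′ i j
  Ψ-cong μ≈ s≈ t≈ i j = Pointwise.lookup (Pointwise.lookup rows≈ i) j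
    where
    rows≈ : Pointwise (Pointwise _≈_) _ _
    rows≈ = (refl ∷ refl ∷ refl ∷ refl ∷ []) ∷ (refl ∷ refl ∷ s≈ ∷ refl ∷ [])
          ∷ (refl ∷ μ≈ ∷ refl ∷ refl ∷ []) ∷ (t≈ ∷ refl ∷ refl ∷ refl ∷ []) ∷ []

  ℓ-cong : ∀ {μ μ′} → μ ≈ μ′ → SameLine (ℓ μ) (ℓ μ′)
  ℓ-cong μ≈μ′ = SameLine-pointwise (λ { 0F → refl ; 1F → μ≈μ′ ; 2F → refl ; 3F → refl }) (λ _ → refl)

  infix 8 _²
  _² : Carrier → Carrier
  x ² = x * x

  Δ≈ad+bc : ∀ a b c d → a * d - b * c ≈ a * d + b * c
  Δ≈ad+bc = solve 4 (λ a b c d → a ⊗ d ⊕ ⊝ (b ⊗ c) ⊜ a ⊗ d ⊕ b ⊗ c) refl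

  module SquareParameter (s : Carrier) (s≉0 : ¬ s ≈ 0#) (s≉1 : ¬ s ≈ 1#) where

    ℓₛ : Line
    ℓₛ = ℓ (s ²)

    ψ : GElt
    ψ = gelt 0# s 1# 0# (s≉0 ∘ trans (sym (solve 1 (λ s → 𝟘 ⊗ 𝟘 ⊕ ⊝ (s ⊗ 𝟙) ⊜ s) refl s)))

    private
      ψ-entry : Fin 4 → Fin 4 → Expr Bool 1 → Expr Bool 1 × Expr Bool 1
      ψ-entry i j s = Mₑ 𝟘 s 𝟙 𝟘 i j ⊜ Ψₑ (s ⊗ s) s (s ⊗ s ⊗ s) i j

    M-ψ : ∀ i j → M ψ i j ≈ Ψ (s ²) s (s ² * s) i j
    M-ψ 0F 0F = solve 1 (ψ-entry 0F 0F) refl s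
    M-ψ 0F 1F = solve 1 (ψ-entry 0F 1F) refl s
    M-ψ 0F 2F = solve 1 (ψ-entry 0F 2F) refl s
    M-ψ 0F 3F = solve 1 (ψ-entry 0F 3F) refl s
    M-ψ 1F 0F = solve 1 (ψ-entry 1F 0F) refl s
    M-ψ 1F 1F = solve 1 (ψ-entry 1F 1F) refl s
    M-ψ 1F 2F = solve 1 (ψ-entry 1F 2F) refl s
    M-ψ 1F 3F = solve 1 (ψ-entry 1F 3F) refl s
    M-ψ 2F 0F = solve 1 (ψ-entry 2F 0F) refl s
    M-ψ 2F 1F = solve 1 (ψ-entry 2F 1F) refl s
    M-ψ 2F 2F = solve 1 (ψ-entry 2F 2F) refl s
    M-ψ 2F 3F = solve 1 (ψ-entry 2F 3F) refl s
    M-ψ 3F 0F = solve 1 (ψ-entry 3F 0F) refl s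
    M-ψ 3F 1F = solve 1 (ψ-entry 3F 1F) refl s
    M-ψ 3F 2F = solve 1 (ψ-entry 3F 2F) refl s
    M-ψ 3F 3F = solve 1 (ψ-entry 3F 3F) refl s

    s³≉0 : ¬ s ² * s ≈ 0#
    s³≉0 = x*y≉0 (x*y≉0 s≉0 s≉0) s≉0

    ψ-fixes : Fixes ℓₛ ψ
    ψ-fixes = SameLine-trans (SameProj⇒SameLine ℓₛ (≈⇒SameProj M-ψ)) (Ψ-fixes-ℓ refl s³≉0)

    idG∼ψ∘ψ : idG ∼ ψ ∘G ψ
    idG∼ψ∘ψ = proportional s s≉0
      (solve 1 (λ s → 𝟘 ⊗ 𝟘 ⊕ 𝟙 ⊗ s ⊜ s ⊗ 𝟙) refl s) (solve 1 (λ s → s ⊗ 𝟘 ⊕ 𝟘 ⊗ s ⊜ s ⊗ 𝟘) refl s)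
      (solve 1 (λ s → 𝟘 ⊗ 𝟙 ⊕ 𝟙 ⊗ 𝟘 ⊜ s ⊗ 𝟘) refl s) (solve 1 (λ s → s ⊗ 𝟙 ⊕ 𝟘 ⊗ 𝟘 ⊜ s ⊗ 𝟙) refl s)

    ψ≁idG : ¬ ψ ∼ idG
    ψ≁idG (proportional κ _ _ _ _ d≈) = 1≉0 (trans d≈ (zeroʳ κ))

    on-ℓₛ : ∀ {w} → InSpan ℓₛ w → w i0 + w i2 ≈ 0# × w i1 + s ² * w i3 ≈ 0#
    on-ℓₛ (α , β , w≈) =
      trans (+-cong (w≈ i0) (w≈ i2)) (solve 2 (λ α β → (α ⊗ 𝟘 ⊕ β ⊗ 𝟙) ⊕ (α ⊗ 𝟘 ⊕ β ⊗ 𝟙) ⊜ 𝟘) refl α β) ,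
      trans (+-cong (w≈ i1) (*-congˡ (w≈ i3)))
            (solve 3 (λ α β s → (α ⊗ (s ⊗ s) ⊕ β ⊗ 𝟘) ⊕ s ⊗ s ⊗ (α ⊗ 𝟙 ⊕ β ⊗ 𝟘) ⊜ 𝟘) refl α β s)

    -- In characteristic 2 each of the four membership conditions factors as a coordinate times a square.
    fixes⇒equations : ∀ {a b c d Δ≉0} → Fixes ℓₛ (gelt a b c d Δ≉0) →
      b * (s * a + b + s * c + d) ² ≈ 0# × d * (s * a + b + s ² * c + s * d) ² ≈ 0# ×
      a * (a + b + c + d) ² ≈ 0# × c * (a + b + s * c + s * d) ² ≈ 0#
    fixes⇒equations {a} {b} {c} {d} (_ , _ , R0g∈ℓ , R∞g∈ℓ) =
      trans (sym (solve 5 (λ s a b c d → (R0ₑ s ·ₑ Mₑ a b c d) 0F ⊕ (R0ₑ s ·ₑ Mₑ a b c d) 2F ⊜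
                                          b ⊗ ((s ⊗ a ⊕ b ⊕ s ⊗ c ⊕ d) ⊗ (s ⊗ a ⊕ b ⊕ s ⊗ c ⊕ d))) refl s a b c d))
            (proj₁ (on-ℓₛ R0g∈ℓ)) ,
      trans (sym (solve 5 (λ s a b c d → (R0ₑ s ·ₑ Mₑ a b c d) 1F ⊕ s ⊗ s ⊗ (R0ₑ s ·ₑ Mₑ a b c d) 3F ⊜
                                          d ⊗ ((s ⊗ a ⊕ b ⊕ s ⊗ s ⊗ c ⊕ s ⊗ d) ⊗ (s ⊗ a ⊕ b ⊕ s ⊗ s ⊗ c ⊕ s ⊗ d))) refl s a b c d))
            (proj₂ (on-ℓₛ R0g∈ℓ)) ,
      trans (sym (solve 4 (λ a b c d → (R∞ₑ ·ₑ Mₑ a b c d) 0F ⊕ (R∞ₑ ·ₑ Mₑ a b c d) 2F ⊜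
                                        a ⊗ ((a ⊕ b ⊕ c ⊕ d) ⊗ (a ⊕ b ⊕ c ⊕ d))) refl a b c d))
            (proj₁ (on-ℓₛ R∞g∈ℓ)) ,
      trans (sym (solve 5 (λ s a b c d → (R∞ₑ ·ₑ Mₑ a b c d) 1F ⊕ s ⊗ s ⊗ (R∞ₑ ·ₑ Mₑ a b c d) 3F ⊜
                                          c ⊗ ((a ⊕ b ⊕ s ⊗ c ⊕ s ⊗ d) ⊗ (a ⊕ b ⊕ s ⊗ c ⊕ s ⊗ d))) refl s a b c d))
            (proj₂ (on-ℓₛ R∞g∈ℓ))
      where
      R0ₑ : Expr Bool 5 → Fin 4 → Expr Bool 5
      R0ₑ s = vecₑ 𝟘 (s ⊗ s) 𝟘 𝟙

    private
      sum-of-zeros : ∀ {x y z} → x ≈ y + z → y ≈ 0# → z ≈ 0# → x ≈ 0#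
      sum-of-zeros x≈y+z y≈0 z≈0 = trans x≈y+z (x≈0∧y≈0⇒x+y≈0 y≈0 z≈0)

      cancel-1+s : ∀ {x} → (1# + s) * x ≈ 0# → x ≈ 0#
      cancel-1+s = x≉0∧x*y≈0⇒y≈0 (s≉1 ∘ sym ∘ x+y≈0⇒x≈y)

    equations⇒∼ : ∀ {a b c d} (Δ≉0 : ¬ a * d - b * c ≈ 0#) →
      b * (s * a + b + s * c + d) ² ≈ 0# → d * (s * a + b + s ² * c + s * d) ² ≈ 0# →
      a * (a + b + c + d) ² ≈ 0# → c * (a + b + s * c + s * d) ² ≈ 0# →
      idG ∼ gelt a b c d Δ≉0 ⊎ ψ ∼ gelt a b c d Δ≉0
    equations⇒∼ {a} {b} {c} {d} Δ≉0 E₁ E₂ E₃ E₄ with a ≟ 0# | c ≟ 0#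
    ... | yes a≈0 | _ = inj₂ (proportional c c≉0
            (trans a≈0 (sym (zeroʳ c))) (trans b≈sc (*-comm s c)) (sym (*-identityʳ c)) (trans d≈0 (sym (zeroʳ c))))
      where
      bc≉0 : ¬ b * c ≈ 0#
      bc≉0 bc≈0 = Δ≉0 (trans (Δ≈ad+bc a b c d) (x≈0∧y≈0⇒x+y≈0 (trans (*-congʳ a≈0) (zeroˡ d)) bc≈0))
      c≉0 : ¬ c ≈ 0#
      c≉0 = bc≉0 ∘ y≈0⇒x*y≈0
      e₁ : s * a + b + s * c + d ≈ 0#
      e₁ = x≉0∧x*y²≈0⇒y≈0 (bc≉0 ∘ λ b≈0 → trans (*-congʳ b≈0) (zeroˡ c)) E₁
      e₄ : a + b + s * c + s * d ≈ 0#
      e₄ = x≉0∧x*y²≈0⇒y≈0 c≉0 E₄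
      d≈0 : d ≈ 0#
      d≈0 = trans (sym (x+y≈0⇒x≈y (cancel-1+s (sum-of-zeros (solve 5 (λ s a b c d →
              (𝟙 ⊕ s) ⊗ (a ⊕ d) ⊜ (s ⊗ a ⊕ b ⊕ s ⊗ c ⊕ d) ⊕ (a ⊕ b ⊕ s ⊗ c ⊕ s ⊗ d)) refl s a b c d) e₁ e₄)))) a≈0
      b≈sc : b ≈ s * c
      b≈sc = x+y≈0⇒x≈y (sum-of-zeros (solve 5 (λ s a b c d →
               b ⊕ s ⊗ c ⊜ (a ⊕ b ⊕ s ⊗ c ⊕ s ⊗ d) ⊕ (a ⊕ s ⊗ d)) refl s a b c d)
               e₄ (x≈0∧y≈0⇒x+y≈0 a≈0 (y≈0⇒x*y≈0 d≈0)))
    ... | no a≉0 | yes c≈0 = inj₁ (proportional a a≉0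
            (sym (*-identityʳ a)) (trans b≈0 (sym (zeroʳ a))) (trans c≈0 (sym (zeroʳ a))) (trans (sym a≈d) (sym (*-identityʳ a))))
      where
      ad≉0 : ¬ a * d ≈ 0#
      ad≉0 ad≈0 = Δ≉0 (trans (Δ≈ad+bc a b c d) (x≈0∧y≈0⇒x+y≈0 ad≈0 (y≈0⇒x*y≈0 c≈0)))
      e₂ : s * a + b + s ² * c + s * d ≈ 0#
      e₂ = x≉0∧x*y²≈0⇒y≈0 (ad≉0 ∘ y≈0⇒x*y≈0) E₂
      e₃ : a + b + c + d ≈ 0#
      e₃ = x≉0∧x*y²≈0⇒y≈0 a≉0 E₃
      b≈0 : b ≈ 0#
      b≈0 = cancel-1+s (sum-of-zeros (solve 5 (λ s a b c d →
              (𝟙 ⊕ s) ⊗ b ⊜ (s ⊗ a ⊕ b ⊕ s ⊗ s ⊗ c ⊕ s ⊗ d) ⊕ (s ⊗ (a ⊕ b ⊕ c ⊕ d) ⊕ (s ⊗ s ⊕ s) ⊗ c)) refl s a b c d)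
              e₂ (x≈0∧y≈0⇒x+y≈0 (y≈0⇒x*y≈0 e₃) (y≈0⇒x*y≈0 c≈0)))
      a≈d : a ≈ d
      a≈d = x+y≈0⇒x≈y (sum-of-zeros (solve 4 (λ a b c d → a ⊕ d ⊜ (a ⊕ b ⊕ c ⊕ d) ⊕ (b ⊕ c)) refl a b c d)
              e₃ (x≈0∧y≈0⇒x+y≈0 b≈0 c≈0))
    ... | no a≉0 | no c≉0 = contradiction Δ≈0 Δ≉0
      where
      e₃ : a + b + c + d ≈ 0#
      e₃ = x≉0∧x*y²≈0⇒y≈0 a≉0 E₃
      e₄ : a + b + s * c + s * d ≈ 0#
      e₄ = x≉0∧x*y²≈0⇒y≈0 c≉0 E₄
      c+d≈0 : c + d ≈ 0#
      c+d≈0 = cancel-1+s (sum-of-zeros (solve 5 (λ s a b c d →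
                (𝟙 ⊕ s) ⊗ (c ⊕ d) ⊜ (a ⊕ b ⊕ c ⊕ d) ⊕ (a ⊕ b ⊕ s ⊗ c ⊕ s ⊗ d)) refl s a b c d) e₃ e₄)
      a+b≈0 : a + b ≈ 0#
      a+b≈0 = sum-of-zeros (solve 4 (λ a b c d → a ⊕ b ⊜ (a ⊕ b ⊕ c ⊕ d) ⊕ (c ⊕ d)) refl a b c d) e₃ c+d≈0
      Δ≈0 : a * d - b * c ≈ 0#
      Δ≈0 = sum-of-zeros (solve 4 (λ a b c d → a ⊗ d ⊕ ⊝ (b ⊗ c) ⊜ (a ⊕ b) ⊗ c ⊕ a ⊗ (c ⊕ d)) refl a b c d)
              (trans (*-comm _ c) (y≈0⇒x*y≈0 a+b≈0)) (y≈0⇒x*y≈0 c+d≈0)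

    Fixes⇒∼ : ∀ g → Fixes ℓₛ g → idG ∼ g ⊎ ψ ∼ g
    Fixes⇒∼ (gelt a b c d Δ≉0) fixes =
      let E₁ , E₂ , E₃ , E₄ = fixes⇒equations {Δ≉0 = Δ≉0} fixes in equations⇒∼ Δ≉0 E₁ E₂ E₃ E₄


    stabiliser : HasSize (Fixes ℓₛ) _≈G_ 2
    stabiliser = idG ∷ ψ ∷ [] , fixes , distinct , covers
      where
      fixes : ∀ i → Fixes ℓₛ (lookup (idG ∷ ψ ∷ []) i)
      fixes 0F = idG-fixes ℓₛ
      fixes 1F = ψ-fixes
      distinct : ∀ i j → lookup (idG ∷ ψ ∷ []) i ≈G lookup (idG ∷ ψ ∷ []) j → i ≡ j
      distinct 0F 0F _ = ≡.refl
      distinct 0F 1F (λ′ , λ′≉0 , M≈) = contradiction (begin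
        λ′            ≈⟨ *-identityʳ λ′ ⟨
        λ′ * 1#       ≈⟨ *-congˡ (M-idG 0F 0F) ⟨
        λ′ * M idG 0F 0F ≈⟨ M≈ 0F 0F ⟨
        M ψ 0F 0F     ≈⟨ M-ψ 0F 0F ⟩
        0#            ∎) λ′≉0
        where open ≈-Reasoning
      distinct 1F 0F (λ′ , _ , M≈) = contradiction (begin
        1#              ≈⟨ M-idG 0F 0F ⟨
        M idG 0F 0F     ≈⟨ M≈ 0F 0F ⟩
        λ′ * M ψ 0F 0F  ≈⟨ y≈0⇒x*y≈0 (M-ψ 0F 0F) ⟩
        0#              ∎) 1≉0
        where open ≈-Reasoning
      distinct 1F 1F _ = ≡.refl
      covers : ∀ g → Fixes ℓₛ g → ∃ λ i → g ≈G lookup (idG ∷ ψ ∷ []) i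
      covers g fixes with Fixes⇒∼ g fixes
      ... | inj₁ idG∼g = 0F , ∼⇒≈G (∼-sym idG∼g)
      ... | inj₂ ψ∼g   = 1F , ∼⇒≈G (∼-sym ψ∼g)


    same-image : ∀ g h → SameLine (ℓₛ ·ᴸ M g) (ℓₛ ·ᴸ M h) → g ∼ h ⊎ ψ ∘G g ∼ h
    same-image g h ℓg≈ℓh =
      Sum.map (λ idG∼hg⁻¹ → ∼-trans (∼-sym (∘G-identityˡ g)) (∼-∘G-adjoint g idG∼hg⁻¹)) (∼-∘G-adjoint g)
              (Fixes⇒∼ (h ∘G adjoint g) (SameLine-image⇒Fixes ℓₛ g h ℓg≈ℓh))

    ψ∘ψ∘g∼g : ∀ g → ψ ∘G (ψ ∘G g) ∼ g
    ψ∘ψ∘g∼g g = begin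
      ψ ∘G (ψ ∘G g)   ≈⟨ ∘G-assoc ψ ψ g ⟨
      (ψ ∘G ψ) ∘G g   ≈⟨ ∘G-congʳ g idG∼ψ∘ψ ⟨
      idG ∘G g        ≈⟨ ∘G-identityˡ g ⟩
      g               ∎
      where open ∼-Reasoning


    orbit : HasSize (InOrbit ℓₛ) SameLine (|G| / 2)
    orbit = hasSize-half {P = InOrbit ℓₛ} {_~_ = SameLine} image σ σ-involutive σ-fixpointFree (λ x → representative x , SameLine-refl)
                         covers fibre partner
      where
      image : Fin |G| → Line
      image x = ℓₛ ·ᴸ M (representative x)
      σ : Fin |G| → Fin |G|
      σ x = proj₁ (representative-surjective (ψ ∘G representative x))
      ψ∘r∼r∘σ : ∀ x → ψ ∘G representative x ∼ representative (σ x)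
      ψ∘r∼r∘σ x = proj₂ (representative-surjective (ψ ∘G representative x))
      σ-involutive : ∀ x → σ (σ x) ≡ x
      σ-involutive x = ≡.sym (representative-injective (begin
        representative x                ≈⟨ ψ∘ψ∘g∼g _ ⟨
        ψ ∘G (ψ ∘G representative x)    ≈⟨ ∘G-congˡ ψ (ψ∘r∼r∘σ x) ⟩
        ψ ∘G representative (σ x)       ≈⟨ ψ∘r∼r∘σ (σ x) ⟩
        representative (σ (σ x))        ∎))
        where open ∼-Reasoning
      σ-fixpointFree : ∀ x → σ x ≢ x
      σ-fixpointFree x σx≡x = ψ≁idG (∘G-cancelʳ (representative x) (begin
        ψ ∘G representative x     ≈⟨ ψ∘r∼r∘σ x ⟩
        representative (σ x)      ≡⟨ ≡.cong representative σx≡x ⟩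
        representative x          ≈⟨ ∘G-identityˡ _ ⟨
        idG ∘G representative x   ∎))
        where open ∼-Reasoning
      covers : ∀ L → InOrbit ℓₛ L → ∃ λ x → SameLine L (image x)
      covers L (g , ℓg≈L) = x , SameLine-trans (SameLine-sym ℓg≈L) (SameProj⇒SameLine ℓₛ (∼⇒≈G g∼rx))
        where
        x : Fin |G|
        x = proj₁ (representative-surjective g)
        g∼rx : g ∼ representative x
        g∼rx = proj₂ (representative-surjective g)
      fibre : ∀ x y → SameLine (image x) (image y) → y ≡ x ⊎ y ≡ σ x
      fibre x y ℓx≈ℓy = Sum.map (λ rx∼ry → ≡.sym (representative-injective rx∼ry))
                                (λ ψrx∼ry → ≡.sym (representative-injective (∼-trans (∼-sym (ψ∘r∼r∘σ x)) ψrx∼ry)))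
                                (same-image _ _ ℓx≈ℓy)
      partner : ∀ {L} x → SameLine L (image x) → SameLine L (image (σ x))
      partner {L} x L≈ℓx = begin
        L                                        ≈⟨ L≈ℓx ⟩
        ℓₛ ·ᴸ M (representative x)               ≈⟨ Fixes⇒·ᴸ-∘G ℓₛ ψ (representative x) ψ-fixes ⟨
        ℓₛ ·ᴸ M (ψ ∘G representative x)          ≈⟨ SameProj⇒SameLine ℓₛ (∼⇒≈G (ψ∘r∼r∘σ x)) ⟩
        ℓₛ ·ᴸ M (representative (σ x))           ∎
        where open LineReasoning

  module SquareRootOf (μ : Carrier) (μ≉0 : ¬ μ ≈ 0#) (μ≉1 : ¬ μ ≈ 1#) where

    s : Carrier
    s = proj₁ (square-root μ)

    s²≈μ : s ² ≈ μ
    s²≈μ = proj₂ (square-root μ)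

    s≉0 : ¬ s ≈ 0#
    s≉0 s≈0 = μ≉0 (trans (sym s²≈μ) (trans (*-congʳ s≈0) (zeroˡ s)))

    s≉1 : ¬ s ≈ 1#
    s≉1 s≈1 = μ≉1 (trans (sym s²≈μ) (trans (*-cong s≈1 s≈1) (*-identityˡ 1#)))

    open SquareParameter s s≉0 s≉1 public

    ℓₛ≈ℓμ : SameLine ℓₛ (ℓ μ)
    ℓₛ≈ℓμ = ℓ-cong s²≈μ

    stabiliser-ℓμ : HasSize (Fixes (ℓ μ)) _≈G_ 2
    stabiliser-ℓμ = hasSize-resp {_~_ = _≈G_} (λ g → Fixes-resp g ℓₛ≈ℓμ) (λ g → Fixes-resp g (SameLine-sym ℓₛ≈ℓμ)) stabiliser

    orbit-ℓμ : HasSize (InOrbit (ℓ μ)) SameLine (|G| / 2)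
    orbit-ℓμ = hasSize-resp {_~_ = SameLine} (λ L → InOrbit-resp L ℓₛ≈ℓμ) (λ L → InOrbit-resp L (SameLine-sym ℓₛ≈ℓμ)) orbit

    ψ-fixes-ℓμ : Fixes (ℓ μ) ψ
    ψ-fixes-ℓμ = Fixes-resp ψ ℓₛ≈ℓμ ψ-fixes

    [μs]²≈μ³ : ∀ {s′} → s′ * s′ ≈ μ → (μ * s′) * (μ * s′) ≈ μ * μ * μ
    [μs]²≈μ³ {s′} s′²≈μ = trans (solve 2 (λ μ s → (μ ⊗ s) ⊗ (μ ⊗ s) ⊜ μ ⊗ μ ⊗ (s ⊗ s)) refl μ s′) (*-congˡ s′²≈μ)

    module _ {s′ t′ : Carrier} (s′²≈μ : s′ * s′ ≈ μ) (t′²≈μ³ : t′ * t′ ≈ μ * μ * μ) where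

      t′≈μs′ : t′ ≈ μ * s′
      t′≈μs′ = x²≈y²⇒x≈y (trans t′²≈μ³ (sym ([μs]²≈μ³ s′²≈μ)))

      t′≉0 : ¬ t′ ≈ 0#
      t′≉0 = x*y≉0 μ≉0 s′≉0 ∘ trans (sym t′≈μs′)
        where
        s′≉0 : ¬ s′ ≈ 0#
        s′≉0 s′≈0 = μ≉0 (trans (sym s′²≈μ) (y≈0⇒x*y≈0 s′≈0))

      ψ≈Ψ : SameProj (M ψ) (Ψ μ s′ t′)
      ψ≈Ψ = ≈⇒SameProj λ i j → trans (M-ψ i j) (Ψ-cong s²≈μ s≈s′ s³≈t′ i j)
        where
        s≈s′ : s ≈ s′
        s≈s′ = x²≈y²⇒x≈y (trans s²≈μ (sym s′²≈μ))
        s³≈t′ : s ² * s ≈ t′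
        s³≈t′ = sym (trans t′≈μs′ (*-cong (sym s²≈μ) (sym s≈s′)))

      Fixes⇒≈Ψ : ∀ g → Fixes (ℓ μ) g → ¬ SameProj (M g) I4 → SameProj (M g) (Ψ μ s′ t′)
      Fixes⇒≈Ψ g fixes g≉I4 = Sum.[ (λ idG∼g → contradiction (SameProj-trans (∼⇒≈G (∼-sym idG∼g)) (≈⇒SameProj M-idG)) g≉I4)
                                  , (λ ψ∼g → SameProj-trans (∼⇒≈G (∼-sym ψ∼g)) ψ≈Ψ) ]
                                  (Fixes⇒∼ g (Fixes-resp g (SameLine-sym ℓₛ≈ℓμ) fixes))

theorem5p2 : (F : FiniteField) → let open Geometry F in
    2 ∣ order → 8 ≤ order →
    (μ : Carrier) → ¬ (μ ≈ 0#) → ¬ (μ ≈ 1#) →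
      HasSize (Fixes (ℓ μ)) _≈G_ 2
      × HasSize (InOrbit (ℓ μ)) SameLine ((order ^ 3 ∸ order) / 2)
      × (∃ λ s → s * s ≈ μ)
      × (∃ λ t → t * t ≈ μ * μ * μ)
      × ((s t : Carrier) → s * s ≈ μ → t * t ≈ μ * μ * μ →
          ((g : GElt) → Fixes (ℓ μ) g → ¬ SameProj (M g) I4 → SameProj (M g) (Ψ μ s t))
          × (∃ λ (g : GElt) → Fixes (ℓ μ) g × SameProj (M g) (Ψ μ s t))
          × SamePoint (R∞ · Ψ μ s t) (R0 μ)
          × SamePoint (R0 μ · Ψ μ s t) R∞)
theorem5p2 F 2∣q _ μ μ≉0 μ≉1 =
    stabiliser-ℓμ
  , ≡.subst (λ n → HasSize (InOrbit (ℓ μ)) SameLine (n / 2)) |G|≡q³-q orbit-ℓμ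
  , (s , s²≈μ)
  , (μ * s , [μs]²≈μ³ s²≈μ)
  , λ s′ t′ s′²≈μ t′²≈μ³ →
        Fixes⇒≈Ψ s′²≈μ t′²≈μ³
      , (ψ , ψ-fixes-ℓμ , ψ≈Ψ s′²≈μ t′²≈μ³)
      , R∞·Ψ∼R0 μ s′ t′
      , R0·Ψ∼R∞ (t′≈μs′ s′²≈μ t′²≈μ³) (t′≉0 s′²≈μ t′²≈μ³)
  where
  open Geometry F
  open FiniteFieldFacts F
  open Char2Geometry F (char2 2∣q)
  open SquareRootOf μ μ≉0 μ≉1

  |G|≡q³-q : |G| ≡ order ^ 3 ∸ order
  |G|≡q³-q = ≡.trans (|PGL₂| q₋₁) (≡.cong (λ q → q ^ 3 ∸ q) (≡.sym order≡1+q₋₁))
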